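{- Let $p \ge 5$ be prime, $G = C_3 \oplus C_{3p}$, $H_1 \cong C_3^2$ the subgroup of elements of order dividing $3$, $H_2$ the subgroup of elements of order dividing $p$, and $\pi_1 : G = H_1 \oplus H_2 \to H_1$ the projection. Let $S$ be a squarefree sequence over $G$ of length $3p+3$. If $\sigma(\pi_1(S)) = 0$ and the set of elements occurring in $\pi_1(S)$ is not all of $H_1$, then $S$ has a subsequence of length $3p$ with sum $0$.
   Context: A sequence over $G$ is a finite unordered list of elements of $G$; it is squarefree if its terms are distinct; $\sigma$ denotes the sum of the terms. For a sequence $S = g_1\cdots g_\ell$, $\pi_1(S) = \pi_1(g_1)\cdots\pi_1(g_\ell)$ is the sequence of images (same length, possibly with repetitions). -}

module Defs where

open import Data.Nat using (ℕ; suc; _+_; _*_)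
open import Data.Nat.DivMod using (_mod_)
open import Data.Nat.Divisibility using (_∣_)
open import Data.Fin using (Fin; toℕ)
open import Data.Product using (_×_; _,_; proj₁; proj₂)
open import Data.List using (List; map)
open import Data.Nat.ListAction using (sum)

G : ℕ → Set
G p = Fin 3 × Fin (3 * p)

-- multiplication of a residue by a natural number, in ℤ/n
-- (pattern matching on n: Fin n inhabited forces n = suc m)
_·ₙ_ : ∀ {n} → ℕ → Fin n → Fin n
_·ₙ_ {suc m} k x = (k * toℕ x) mod suc m

InH₁ : ∀ p → G p → Set
InH₁ p (a , x) = (3 * p) ∣ (3 * toℕ x)

-- Since p is prime ≥ 5, p² ≡ 1 (mod 3)
-- and p² ≡ 0 (mod p), so e = p² is the idempotent of ℤ/3p projecting onto the
-- 3-torsion part; hence π₁(a , x) = (a , p²·x).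
π₁ : ∀ p → G p → G p
π₁ p (a , x) = a , ((p * p) ·ₙ x)

σ≡0 : ∀ p → List (G p) → Set
σ≡0 p S = (3 ∣ sum (map (λ g → toℕ (proj₁ g)) S))
        × ((3 * p) ∣ sum (map (λ g → toℕ (proj₂ g)) S))

module Submission where

open import Defs
open import Data.Nat using (ℕ; _+_; _*_; _≤_)
open import Data.Nat.Primality using (Prime)
open import Data.Product using (Σ; _×_)
open import Data.List using (List; length; map)
open import Data.List.Membership.Propositional using (_∈_)
open import Data.List.Relation.Unary.Unique.Propositional using (Unique)
open import Data.List.Relation.Binary.Sublist.Propositional using (_⊆_)
open import Relation.Binary.PropositionalEquality using (_≡_)
open import Relation.Nullary using (¬_)
open import Data.Nat using (suc; _<_; NonZero)
open import Data.Nat.Properties using (anyUpTo?; _≤?_; _≟_; n≢0⇒n>0)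
open import Data.Product using (∃-syntax; _,_)
open import Data.Empty using (⊥-elim)
open import Relation.Nullary using (Dec; yes; no)

-- Record g ∈ G by its H₁-part, a point of the plane (ℤ/3)² labelled by a
-- class c ∈ [0,9), and its H₂-part, a residue mod p.  Let A_c ⊆ ℤ/p be the residues
-- of the elements of S in class c; as S is squarefree, Σ_c |A_c| = 3p + 3.  Since
-- σ(π₁(S)) = 0, it suffices to delete three distinct elements whose classes sum to
-- zero in H₁ and whose residues sum to the H₂-part t of σ(S).  With p = 2h + 1:
--  * if some |A_c| ≥ h + 3, three distinct elements of A_c sum to t;
--  * otherwise every |A_c| ≤ h + 2 and some A_m is empty (π₁(S) ≠ H₁); then some line
--    {i, j, k} of the affine plane AG(2,3) has nonempty A_i, A_j, A_k of total size
--    at least p + 2, so that t ∈ A_i + A_j + A_k.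
-- Both cases rest on the Cauchy–Davenport theorem.

module Counting where

  open import Data.Nat
  open import Data.Nat.Properties
  open import Data.Nat.DivMod using (_%_; n%n≡0; m<n⇒m%n≡m)
  open import Data.Bool using (Bool; true; false; _∧_; _∨_; not; T)
  open import Data.Product using (Σ-syntax; _×_; _,_)
  open import Data.Empty using (⊥-elim)
  open import Relation.Binary.PropositionalEquality
  open import Relation.Nullary using (¬_; yes; no)
  open import Algebra.Properties.CommutativeSemigroup +-commutativeSemigroup using (interchange; x∙yz≈y∙xz)

  ∧-intro : ∀ {u v} → u ≡ true → v ≡ true → (u ∧ v) ≡ true
  ∧-intro refl refl = refl

  ∧-l : ∀ {u v} → (u ∧ v) ≡ true → u ≡ true
  ∧-l {true} _ = refl

  ∧-r : ∀ {u v} → (u ∧ v) ≡ true → v ≡ true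
  ∧-r {true} e = e

  b2n : Bool → ℕ
  b2n true = 1
  b2n false = 0

  count : ℕ → (ℕ → Bool) → ℕ
  count zero A = 0
  count (suc n) A = b2n (A n) + count n A

  private
    below-pred : ∀ {x n} → x < suc n → ¬ x ≡ n → x < n
    below-pred x<1+n x≢n = ≤∧≢⇒< (≤-pred x<1+n) x≢n

  count-cong : ∀ n {A B : ℕ → Bool} → (∀ x → x < n → A x ≡ B x) → count n A ≡ count n B
  count-cong zero h = refl
  count-cong (suc n) h = cong₂ _+_ (cong b2n (h n ≤-refl)) (count-cong n (λ x x<n → h x (m≤n⇒m≤1+n x<n)))

  count-≤ : ∀ n A → count n A ≤ n
  count-≤ zero A = z≤n
  count-≤ (suc n) A = +-mono-≤ (b2n≤1 (A n)) (count-≤ n A)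
    where
    b2n≤1 : ∀ b → b2n b ≤ 1
    b2n≤1 true = ≤-refl
    b2n≤1 false = z≤n

  count-mono : ∀ n {A B : ℕ → Bool} → (∀ x → x < n → A x ≡ true → B x ≡ true) → count n A ≤ count n B
  count-mono zero h = z≤n
  count-mono (suc n) h = +-mono-≤ (b2n-mono (h n ≤-refl)) (count-mono n (λ x x<n → h x (m≤n⇒m≤1+n x<n)))
    where
    b2n-mono : ∀ {a b} → (a ≡ true → b ≡ true) → b2n a ≤ b2n b
    b2n-mono {false} _ = z≤n
    b2n-mono {true} a⇒b rewrite a⇒b refl = ≤-refl

  count-∪∩ : ∀ n (A B : ℕ → Bool) → count n (λ x → A x ∨ B x) + count n (λ x → A x ∧ B x) ≡ count n A + count n B
  count-∪∩ zero A B = refl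
  count-∪∩ (suc n) A B = begin
    (b2n (A n ∨ B n) + count n A∪B) + (b2n (A n ∧ B n) + count n A∩B)
      ≡⟨ interchange (b2n (A n ∨ B n)) _ _ _ ⟩
    (b2n (A n ∨ B n) + b2n (A n ∧ B n)) + (count n A∪B + count n A∩B)
      ≡⟨ cong₂ _+_ (b2n-∪∩ (A n) (B n)) (count-∪∩ n A B) ⟩
    (b2n (A n) + b2n (B n)) + (count n A + count n B)
      ≡⟨ interchange (b2n (A n)) _ _ _ ⟩
    (b2n (A n) + count n A) + (b2n (B n) + count n B) ∎
    where
    open ≡-Reasoning
    A∪B A∩B : ℕ → Bool
    A∪B x = A x ∨ B x
    A∩B x = A x ∧ B x
    b2n-∪∩ : ∀ a b → b2n (a ∨ b) + b2n (a ∧ b) ≡ b2n a + b2n b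
    b2n-∪∩ true true = refl
    b2n-∪∩ true false = refl
    b2n-∪∩ false true = refl
    b2n-∪∩ false false = refl

  count-split : ∀ n (A C : ℕ → Bool) → count n A ≡ count n (λ x → A x ∧ C x) + count n (λ x → A x ∧ not (C x))
  count-split zero A C = refl
  count-split (suc n) A C = begin
    b2n (A n) + count n A
      ≡⟨ cong₂ _+_ (b2n-split (A n) (C n)) (count-split n A C) ⟩
    (b2n (A n ∧ C n) + b2n (A n ∧ not (C n))) + (count n (λ x → A x ∧ C x) + count n (λ x → A x ∧ not (C x)))
      ≡⟨ interchange (b2n (A n ∧ C n)) _ _ _ ⟩
    (b2n (A n ∧ C n) + count n (λ x → A x ∧ C x)) + (b2n (A n ∧ not (C n)) + count n (λ x → A x ∧ not (C x))) ∎
    where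
    open ≡-Reasoning
    b2n-split : ∀ a c → b2n a ≡ b2n (a ∧ c) + b2n (a ∧ not c)
    b2n-split true true = refl
    b2n-split true false = refl
    b2n-split false c = refl

  count-pos : ∀ n (A : ℕ → Bool) → 1 ≤ count n A → Σ[ x ∈ ℕ ] x < n × A x ≡ true
  count-pos (suc n) A h with A n in eq
  ... | true = n , ≤-refl , eq
  ... | false with count-pos n A h
  ...   | x , x<n , Ax = x , m≤n⇒m≤1+n x<n , Ax

  count-wit : ∀ n (A : ℕ → Bool) x → x < n → A x ≡ true → 1 ≤ count n A
  count-wit (suc n) A x x<n Ax with x ≟ n
  ... | yes refl rewrite Ax = s≤s z≤n
  ... | no x≢n = ≤-trans (count-wit n A x (below-pred x<n x≢n) Ax) (m≤n+m _ _)

  count-full : ∀ n (A : ℕ → Bool) → n ≤ count n A → ∀ x → x < n → A x ≡ true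
  count-full (suc n) A h x x<n with A n in eq
  ... | false = ⊥-elim (<-irrefl refl (≤-trans h (count-≤ n A)))
  ... | true with x ≟ n
  ...   | yes refl = eq
  ...   | no x≢n = count-full n A (≤-pred h) x (below-pred x<n x≢n)

  count-all : ∀ n (A : ℕ → Bool) → (∀ x → x < n → A x ≡ true) → count n A ≡ n
  count-all zero A h = refl
  count-all (suc n) A h rewrite h n ≤-refl = cong suc (count-all n A (λ x x<n → h x (m≤n⇒m≤1+n x<n)))

  count-none : ∀ n (A : ℕ → Bool) → (∀ x → x < n → A x ≡ false) → count n A ≡ 0
  count-none zero A h = refl
  count-none (suc n) A h rewrite h n ≤-refl = count-none n A (λ x x<n → h x (m≤n⇒m≤1+n x<n))

  count-peel : ∀ n (A : ℕ → Bool) → count (suc n) A ≡ b2n (A 0) + count n (λ x → A (suc x))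
  count-peel zero A = refl
  count-peel (suc n) A = begin
    b2n (A (suc n)) + count (suc n) A
      ≡⟨ cong (b2n (A (suc n)) +_) (count-peel n A) ⟩
    b2n (A (suc n)) + (b2n (A 0) + count n (λ x → A (suc x)))
      ≡⟨ x∙yz≈y∙xz (b2n (A (suc n))) (b2n (A 0)) _ ⟩
    b2n (A 0) + (b2n (A (suc n)) + count n (λ x → A (suc x))) ∎
    where open ≡-Reasoning

  count-+ : ∀ a b (A : ℕ → Bool) → count (a + b) A ≡ count a (λ k → A (b + k)) + count b A
  count-+ zero b A = refl
  count-+ (suc a) b A = begin
    b2n (A (a + b)) + count (a + b) A
      ≡⟨ cong₂ _+_ (cong (λ z → b2n (A z)) (+-comm a b)) (count-+ a b A) ⟩
    b2n (A (b + a)) + (count a (λ k → A (b + k)) + count b A)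
      ≡⟨ sym (+-assoc (b2n (A (b + a))) _ _) ⟩
    b2n (A (b + a)) + count a (λ k → A (b + k)) + count b A ∎
    where open ≡-Reasoning

  ≡ᵇ-refl : ∀ v → (v ≡ᵇ v) ≡ true
  ≡ᵇ-refl zero = refl
  ≡ᵇ-refl (suc v) = ≡ᵇ-refl v

  ≢⇒≡ᵇfalse : ∀ x v → ¬ x ≡ v → (x ≡ᵇ v) ≡ false
  ≢⇒≡ᵇfalse zero zero x≢v = ⊥-elim (x≢v refl)
  ≢⇒≡ᵇfalse zero (suc v) x≢v = refl
  ≢⇒≡ᵇfalse (suc x) zero x≢v = refl
  ≢⇒≡ᵇfalse (suc x) (suc v) x≢v = ≢⇒≡ᵇfalse x v (λ e → x≢v (cong suc e))

  ≡ᵇtrue⇒≡ : ∀ x v → (x ≡ᵇ v) ≡ true → x ≡ v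
  ≡ᵇtrue⇒≡ x v e = ≡ᵇ⇒≡ x v (subst T (sym e) _)

  ≡ᵇ-sym : ∀ a b → (a ≡ᵇ b) ≡ (b ≡ᵇ a)
  ≡ᵇ-sym zero zero = refl
  ≡ᵇ-sym zero (suc b) = refl
  ≡ᵇ-sym (suc a) zero = refl
  ≡ᵇ-sym (suc a) (suc b) = ≡ᵇ-sym a b

  count-singleton : ∀ n v → v < n → count n (λ x → x ≡ᵇ v) ≡ 1
  count-singleton (suc n) v v<n with v ≟ n
  ... | yes refl rewrite ≡ᵇ-refl v = cong suc (count-none n _ (λ x x<n → ≢⇒≡ᵇfalse x v (λ e → <-irrefl e x<n)))
  ... | no v≢n rewrite ≢⇒≡ᵇfalse n v (λ e → v≢n (sym e)) = count-singleton n v (below-pred v<n v≢n)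

  count-remove : ∀ n (A : ℕ → Bool) v → v < n → count n A ≤ count n (λ x → A x ∧ not (x ≡ᵇ v)) + 1
  count-remove n A v v<n = begin
    count n A ≡⟨ count-split n A (λ x → x ≡ᵇ v) ⟩
    count n (λ x → A x ∧ (x ≡ᵇ v)) + count n (λ x → A x ∧ not (x ≡ᵇ v)) ≤⟨ +-monoˡ-≤ _ at-most-v ⟩
    1 + count n (λ x → A x ∧ not (x ≡ᵇ v)) ≡⟨ +-comm 1 _ ⟩
    count n (λ x → A x ∧ not (x ≡ᵇ v)) + 1 ∎
    where
    open ≤-Reasoning
    at-most-v : count n (λ x → A x ∧ (x ≡ᵇ v)) ≤ 1
    at-most-v = subst (count n (λ x → A x ∧ (x ≡ᵇ v)) ≤_) (count-singleton n v v<n) (count-mono n (λ x _ e → ∧-r {A x} e))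

  count-rotate : ∀ n .{{_ : NonZero n}} (A : ℕ → Bool) → count n (λ x → A ((x + 1) % n)) ≡ count n A
  count-rotate (suc q) A = begin
    b2n (A ((q + 1) % suc q)) + count q (λ x → A ((x + 1) % suc q))
      ≡⟨ cong₂ (λ u v → b2n (A u) + v) wraps (count-cong q (λ x x<q → cong A (no-wrap x x<q))) ⟩
    b2n (A 0) + count q (λ x → A (suc x)) ≡⟨ sym (count-peel q A) ⟩
    count (suc q) A ∎
    where
    open ≡-Reasoning
    wraps : (q + 1) % suc q ≡ 0
    wraps = trans (cong (_% suc q) (+-comm q 1)) (n%n≡0 (suc q))
    no-wrap : ∀ x → x < q → (x + 1) % suc q ≡ suc x
    no-wrap x x<q = trans (cong (_% suc q) (+-comm x 1)) (m<n⇒m%n≡m (s≤s x<q))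

  sumBelow : ℕ → (ℕ → ℕ) → ℕ
  sumBelow zero f = 0
  sumBelow (suc N) f = f N + sumBelow N f

  sumBelow-cong : ∀ N {f g : ℕ → ℕ} → (∀ x → x < N → f x ≡ g x) → sumBelow N f ≡ sumBelow N g
  sumBelow-cong zero _ = refl
  sumBelow-cong (suc N) f≡g = cong₂ _+_ (f≡g N ≤-refl) (sumBelow-cong N (λ x x<N → f≡g x (m≤n⇒m≤1+n x<N)))

  sumBelow-mono : ∀ N {f g : ℕ → ℕ} → (∀ x → x < N → f x ≤ g x) → sumBelow N f ≤ sumBelow N g
  sumBelow-mono zero _ = z≤n
  sumBelow-mono (suc N) f≤g = +-mono-≤ (f≤g N ≤-refl) (sumBelow-mono N (λ x x<N → f≤g x (m≤n⇒m≤1+n x<N)))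

  sumBelow-+ : ∀ N (f g : ℕ → ℕ) → sumBelow N (λ x → f x + g x) ≡ sumBelow N f + sumBelow N g
  sumBelow-+ zero f g = refl
  sumBelow-+ (suc N) f g = trans (cong (f N + g N +_) (sumBelow-+ N f g)) (interchange (f N) (g N) _ _)

  sumBelow-*ʳ : ∀ N (f : ℕ → ℕ) c → sumBelow N (λ x → f x * c) ≡ sumBelow N f * c
  sumBelow-*ʳ zero f c = refl
  sumBelow-*ʳ (suc N) f c = trans (cong (f N * c +_) (sumBelow-*ʳ N f c)) (sym (*-distribʳ-+ c (f N) (sumBelow N f)))

module Residues (p : ℕ) .{{_ : NonZero p}} where

  open import Data.Nat
  open import Data.Nat.Properties
  open import Data.Nat.DivMod
  open import Relation.Binary.PropositionalEquality
  open import Relation.Nullary using (¬_)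
  open import Data.Empty using (⊥-elim)
  open import Algebra.Properties.CommutativeSemigroup +-commutativeSemigroup using (x∙yz≈y∙xz)

  infix 4 _≋_
  _≋_ : ℕ → ℕ → Set
  a ≋ b = a % p ≡ b % p

  %≋ : ∀ a → a % p ≋ a
  %≋ a = m%n%n≡m%n a p

  +≋ : ∀ {a b c d} → a ≋ b → c ≋ d → a + c ≋ b + d
  +≋ {a} {b} {c} {d} a≋b c≋d = begin
    (a + c) % p ≡⟨ %-distribˡ-+ a c p ⟩
    (a % p + c % p) % p ≡⟨ cong₂ (λ u v → (u + v) % p) a≋b c≋d ⟩
    (b % p + d % p) % p ≡⟨ sym (%-distribˡ-+ b d p) ⟩
    (b + d) % p ∎
    where open ≡-Reasoning

  *≋ : ∀ {a b c d} → a ≋ b → c ≋ d → a * c ≋ b * d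
  *≋ {a} {b} {c} {d} a≋b c≋d = begin
    (a * c) % p ≡⟨ %-distribˡ-* a c p ⟩
    (a % p * (c % p)) % p ≡⟨ cong₂ (λ u v → (u * v) % p) a≋b c≋d ⟩
    (b % p * (d % p)) % p ≡⟨ sym (%-distribˡ-* b d p) ⟩
    (b * d) % p ∎
    where open ≡-Reasoning

  multiple≋0 : ∀ k → k * p ≋ 0
  multiple≋0 k = trans (m*n%n≡0 k p) (sym (m<n⇒m%n≡m (n>0 p)))
    where
    n>0 : ∀ n .{{_ : NonZero n}} → 0 < n
    n>0 (suc n) = s≤s z≤n

  ≋⇒≡ : ∀ {a b} → a < p → b < p → a ≋ b → a ≡ b
  ≋⇒≡ {a} {b} a<p b<p a≋b = trans (sym (m<n⇒m%n≡m a<p)) (trans a≋b (m<n⇒m%n≡m b<p))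

  _⊖_ : ℕ → ℕ → ℕ
  x ⊖ b = (x + (p ∸ b)) % p

  ⊖<p : ∀ x b → x ⊖ b < p
  ⊖<p x b = m%n<n (x + (p ∸ b)) p

  add-then-sub : ∀ a b → b < p → a + b + (p ∸ b) ≋ a
  add-then-sub a b b<p = begin
    (a + b + (p ∸ b)) % p ≡⟨ cong (_% p) (+-assoc a b (p ∸ b)) ⟩
    (a + (b + (p ∸ b))) % p ≡⟨ cong (λ z → (a + z) % p) (m+[n∸m]≡n (<⇒≤ b<p)) ⟩
    (a + p) % p ≡⟨ [m+n]%n≡m%n a p ⟩
    a % p ∎
    where open ≡-Reasoning

  ⊖-+ : ∀ a b → a < p → b < p → ((a + b) % p) ⊖ b ≡ a
  ⊖-+ a b a<p b<p = ≋⇒≡ (⊖<p _ b) a<p (begin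
    ((a + b) % p + (p ∸ b)) % p % p ≡⟨ %≋ _ ⟩
    ((a + b) % p + (p ∸ b)) % p ≡⟨ +≋ {(a + b) % p} {a + b} {p ∸ b} (%≋ (a + b)) refl ⟩
    (a + b + (p ∸ b)) % p ≡⟨ add-then-sub a b b<p ⟩
    a % p ∎)
    where open ≡-Reasoning

  +-⊖ : ∀ x b → x < p → b < p → (x ⊖ b + b) % p ≡ x
  +-⊖ x b x<p b<p = ≋⇒≡ (m%n<n _ p) x<p (begin
    (x ⊖ b + b) % p % p ≡⟨ %≋ _ ⟩
    (x ⊖ b + b) % p ≡⟨ +≋ {x ⊖ b} {x + (p ∸ b)} {b} (%≋ _) refl ⟩
    (x + (p ∸ b) + b) % p ≡⟨ cong (_% p) (swap-last x (p ∸ b) b) ⟩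
    (x + b + (p ∸ b)) % p ≡⟨ add-then-sub x b b<p ⟩
    x % p ∎)
    where
    open ≡-Reasoning
    swap-last : ∀ u v w → u + v + w ≡ u + w + v
    swap-last u v w = trans (+-assoc u v w) (trans (cong (u +_) (+-comm v w)) (sym (+-assoc u w v)))

  %-sum3 : ∀ a b c → (a + b + c) % p ≡ (a % p + b % p + c % p) % p
  %-sum3 a b c = +≋ {a + b} {a % p + b % p} {c} {c % p} (+≋ {a} {a % p} {b} {b % p} (sym (%≋ a)) (sym (%≋ b))) (sym (%≋ c))

  ⊖-nonzero : ∀ x b → x < p → b < p → ¬ x ≡ b → 0 < x ⊖ b
  ⊖-nonzero x b x<p b<p x≢b with x ⊖ b in x-b≡
  ... | suc _ = s≤s z≤n
  ... | zero = ⊥-elim (x≢b (sym (trans (sym (m<n⇒m%n≡m b<p)) (trans (cong (λ z → (z + b) % p) (sym x-b≡)) (+-⊖ x b x<p b<p)))))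

  +⊖-comm : ∀ x y z → (x + y ⊖ z) % p ≡ (y + x ⊖ z) % p
  +⊖-comm x y z = begin
    (x + y ⊖ z) % p ≡⟨ +≋ {x} refl (%≋ (y + (p ∸ z))) ⟩
    (x + (y + (p ∸ z))) % p ≡⟨ cong (_% p) (x∙yz≈y∙xz x y (p ∸ z)) ⟩
    (y + (x + (p ∸ z))) % p ≡⟨ +≋ {y} refl (sym (%≋ (x + (p ∸ z)))) ⟩
    (y + x ⊖ z) % p ∎
    where open ≡-Reasoning

  ⊖-split : ∀ a b c t → a < p → t < p → (b + c) % p ≡ t ⊖ a → (a + b + c) % p ≡ t
  ⊖-split a b c t a<p t<p b+c≡t-a = begin
    (a + b + c) % p ≡⟨ cong (_% p) (+-assoc a b c) ⟩
    (a + (b + c)) % p ≡⟨ +≋ {a} refl (sym (%≋ (b + c))) ⟩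
    (a + (b + c) % p) % p ≡⟨ cong (λ z → (a + z) % p) b+c≡t-a ⟩
    (a + t ⊖ a) % p ≡⟨ cong (_% p) (+-comm a (t ⊖ a)) ⟩
    (t ⊖ a + a) % p ≡⟨ +-⊖ t a t<p a<p ⟩
    t ∎
    where open ≡-Reasoning

module SumSets (p : ℕ) .{{_ : NonZero p}} where

  open import Data.Nat
  open import Data.Nat.Properties
  open import Data.Nat.DivMod
  open import Data.Bool using (Bool; true; _∧_; T)
  open import Data.Product using (Σ-syntax; _×_; _,_)
  open import Relation.Binary.PropositionalEquality
  open Counting
  open Residues p

  ∣_∣ : (ℕ → Bool) → ℕ
  ∣ A ∣ = count p A

  translate : ℕ → (ℕ → Bool) → ℕ → Bool
  translate e A x = A ((x + e) % p)

  ∣translate∣ : ∀ e A → ∣ translate e A ∣ ≡ ∣ A ∣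
  ∣translate∣ zero A = count-cong p (λ x x<p → cong A (trans (cong (_% p) (+-identityʳ x)) (m<n⇒m%n≡m x<p)))
  ∣translate∣ (suc e) A = begin
    ∣ translate (suc e) A ∣ ≡⟨ count-cong p (λ x _ → cong A (step x)) ⟩
    ∣ translate 1 (translate e A) ∣ ≡⟨ count-rotate p (translate e A) ⟩
    ∣ translate e A ∣ ≡⟨ ∣translate∣ e A ⟩
    ∣ A ∣ ∎
    where
    open ≡-Reasoning
    step : ∀ x → (x + suc e) % p ≡ ((x + 1) % p + e) % p
    step x = trans (cong (_% p) (trans (+-suc x e) (cong (_+ e) (+-comm 1 x))))
                   (+≋ {x + 1} {(x + 1) % p} {e} (sym (%≋ (x + 1))) refl)

  exists-below : ℕ → (ℕ → Bool) → Bool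
  exists-below n f = 1 ≤ᵇ count n f

  exists-below-intro : ∀ n f x → x < n → f x ≡ true → exists-below n f ≡ true
  exists-below-intro n f x x<n fx = T⇒≡true (≤⇒≤ᵇ (count-wit n f x x<n fx))
    where
    T⇒≡true : ∀ {b} → T b → b ≡ true
    T⇒≡true {true} _ = refl

  exists-below-elim : ∀ n f → exists-below n f ≡ true → Σ[ x ∈ ℕ ] x < n × f x ≡ true
  exists-below-elim n f e = count-pos n f (≤ᵇ⇒≤ 1 (count n f) (subst T (sym e) _))

  _⊕_ : (ℕ → Bool) → (ℕ → Bool) → ℕ → Bool
  (A ⊕ B) x = exists-below p (λ b → B b ∧ A (x ⊖ b))

  ⊕-intro : ∀ A B a b → a < p → b < p → A a ≡ true → B b ≡ true → (A ⊕ B) ((a + b) % p) ≡ true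
  ⊕-intro A B a b a<p b<p Aa Bb =
    exists-below-intro p _ b b<p (∧-intro Bb (trans (cong A (⊖-+ a b a<p b<p)) Aa))

  ⊕-elim : ∀ A B x → x < p → (A ⊕ B) x ≡ true →
           Σ[ a ∈ ℕ ] Σ[ b ∈ ℕ ] a < p × b < p × A a ≡ true × B b ≡ true × (a + b) % p ≡ x
  ⊕-elim A B x x<p e with exists-below-elim p _ e
  ... | b , b<p , Bb∧A[x-b] = x ⊖ b , b , ⊖<p x b , b<p , ∧-r Bb∧A[x-b] , ∧-l Bb∧A[x-b] , +-⊖ x b x<p b<p

module CauchyDavenport (p : ℕ) .{{_ : NonZero p}} (p-prime : Prime p) where

  open import Data.Nat
  open import Data.Nat.Properties
  open import Data.Nat.DivMod
  open import Data.Nat.Induction using (<-rec)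
  open import Data.Nat.Coprimality using (coprime-Bézout; prime⇒coprime)
  open import Data.Nat.GCD using (module Bézout)
  open import Data.Bool using (Bool; true; false; _∧_; _∨_; not)
  open import Data.Bool.Properties using (∧-comm)
  open import Data.Product using (Σ-syntax; _×_; _,_; proj₁; proj₂)
  open import Data.Sum using (_⊎_; inj₁; inj₂)
  open import Data.Empty using (⊥-elim)
  open import Relation.Binary.PropositionalEquality
  open import Relation.Nullary using (¬_; yes; no)
  open Counting
  open Residues p
  open SumSets p

  inverse : ∀ d → 0 < d → d < p → Σ[ w ∈ ℕ ] d * w ≋ 1
  inverse d@(suc _) _ d<p with coprime-Bézout (prime⇒coprime p-prime d<p)
  ... | Bézout.-+ x y eq = y , (begin
        (d * y) % p ≡⟨ cong (_% p) (trans (*-comm d y) (sym eq)) ⟩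
        (1 + x * p) % p ≡⟨ [m+kn]%n≡m%n 1 x p ⟩
        1 % p ∎)
    where open ≡-Reasoning
  ... | Bézout.+- x y eq = y * (p ∸ 1) , (begin
        (d * (y * (p ∸ 1))) % p ≡⟨ cong (_% p) (trans (sym (*-assoc d y _)) (cong (_* (p ∸ 1)) (*-comm d y))) ⟩
        (yd * (p ∸ 1)) % p ≡⟨ cong (_% p) (sym (+-identityʳ _)) ⟩
        (yd * (p ∸ 1) + 0) % p ≡⟨ +≋ {yd * (p ∸ 1)} refl (sym yd+1≋0) ⟩
        (yd * (p ∸ 1) + (yd + 1)) % p ≡⟨ cong (_% p) regroup ⟩
        (1 + yd * p) % p ≡⟨ [m+kn]%n≡m%n 1 yd p ⟩
        1 % p ∎)
    where
    open ≡-Reasoning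
    yd = y * d
    yd+1≋0 : yd + 1 ≋ 0
    yd+1≋0 = trans (cong (_% p) (trans (+-comm yd 1) eq)) (multiple≋0 x)
    regroup : yd * (p ∸ 1) + (yd + 1) ≡ 1 + yd * p
    regroup = begin
      yd * (p ∸ 1) + (yd + 1) ≡⟨ cong (λ z → yd * (p ∸ 1) + (z + 1)) (sym (*-identityʳ yd)) ⟩
      yd * (p ∸ 1) + (yd * 1 + 1) ≡⟨ sym (+-assoc (yd * (p ∸ 1)) (yd * 1) 1) ⟩
      yd * (p ∸ 1) + yd * 1 + 1 ≡⟨ cong (_+ 1) (sym (*-distribˡ-+ yd (p ∸ 1) 1)) ⟩
      yd * (p ∸ 1 + 1) + 1 ≡⟨ cong (λ z → yd * z + 1) (m∸n+n≡m (≤-trans (s≤s z≤n) d<p)) ⟩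
      yd * p + 1 ≡⟨ +-comm (yd * p) 1 ⟩
      1 + yd * p ∎

  -- A nonempty subset of ℤ/p closed under adding a fixed d ≢ 0 is all of ℤ/p:
  -- a0 + k·d runs through every residue once k ranges over multiples of d⁻¹.
  closed-under-step⇒full : ∀ (A : ℕ → Bool) a0 d → a0 < p → A a0 ≡ true → 0 < d → d < p →
    (∀ a → a < p → A a ≡ true → A ((a + d) % p) ≡ true) → ∀ x → x < p → A x ≡ true
  closed-under-step⇒full A a0 d a0<p Aa0 0<d d<p closed x x<p = subst (λ z → A z ≡ true) reaches-x (iterate k)
    where
    open ≡-Reasoning
    iterate : ∀ k → A ((a0 + k * d) % p) ≡ true
    iterate zero = subst (λ z → A z ≡ true) (sym (trans (cong (_% p) (+-identityʳ a0)) (m<n⇒m%n≡m a0<p))) Aa0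
    iterate (suc k) = subst (λ z → A z ≡ true) step (closed _ (m%n<n _ p) (iterate k))
      where
      step : ((a0 + k * d) % p + d) % p ≡ (a0 + suc k * d) % p
      step = trans (+≋ {(a0 + k * d) % p} {a0 + k * d} {d} (%≋ _) refl)
                   (cong (_% p) (trans (+-assoc a0 (k * d) d) (cong (a0 +_) (+-comm (k * d) d))))
    w : ℕ
    w = proj₁ (inverse d 0<d d<p)
    dw≋1 : d * w ≋ 1
    dw≋1 = proj₂ (inverse d 0<d d<p)
    t = x ⊖ a0
    k = t * w
    reaches-x : (a0 + k * d) % p ≡ x
    reaches-x = ≋⇒≡ (m%n<n _ p) x<p (begin
      (a0 + t * w * d) % p % p ≡⟨ %≋ _ ⟩
      (a0 + t * w * d) % p ≡⟨ cong (λ z → (a0 + z) % p) (trans (*-assoc t w d) (cong (t *_) (*-comm w d))) ⟩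
      (a0 + t * (d * w)) % p ≡⟨ +≋ {a0} refl (*≋ {t} {x + (p ∸ a0)} {d * w} {1} (%≋ _) dw≋1) ⟩
      (a0 + (x + (p ∸ a0)) * 1) % p ≡⟨ cong (_% p) rearrange ⟩
      (x + a0 + (p ∸ a0)) % p ≡⟨ add-then-sub x a0 a0<p ⟩
      x % p ∎)
      where
      rearrange : a0 + (x + (p ∸ a0)) * 1 ≡ x + a0 + (p ∸ a0)
      rearrange = trans (cong (a0 +_) (*-identityʳ _)) (trans (sym (+-assoc a0 x _)) (cong (_+ (p ∸ a0)) (+-comm a0 x)))

  CDBound : (ℕ → Bool) → (ℕ → Bool) → Set
  CDBound A B = p ≤ ∣ A ⊕ B ∣ ⊎ ∣ A ∣ + ∣ B ∣ ≤ suc ∣ A ⊕ B ∣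

  -- |A + B| ≥ |A| whenever B is nonempty, since A + b ⊆ A + B
  ∣A∣≤∣A⊕B∣ : ∀ A B b → b < p → B b ≡ true → ∣ A ∣ ≤ ∣ A ⊕ B ∣
  ∣A∣≤∣A⊕B∣ A B b b<p Bb = subst (_≤ ∣ A ⊕ B ∣) (∣translate∣ (p ∸ b) A)
    (count-mono p (λ x x<p Ax → exists-below-intro p _ b b<p (∧-intro Bb Ax)))

  -- Dyson's e-transform: for e ∈ ℤ/p put A' = A ∪ (B + e) and B' = B ∩ (A - e).
  -- It preserves |A| + |B| and does not enlarge the sumset.
  module DysonTransform (A B : ℕ → Bool) (e : ℕ) (e<p : e < p) where

    B+e : ℕ → Bool
    B+e = translate (p ∸ e) B

    A' B' : ℕ → Bool
    A' x = A x ∨ B+e x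
    B' x = B x ∧ translate e A x

    size-preserved : ∣ A' ∣ + ∣ B' ∣ ≡ ∣ A ∣ + ∣ B ∣
    size-preserved = begin
      ∣ A' ∣ + ∣ B' ∣ ≡⟨ cong (∣ A' ∣ +_) ∣B'∣≡∣A∩[B+e]∣ ⟩
      ∣ A' ∣ + ∣ (λ x → A x ∧ B+e x) ∣ ≡⟨ count-∪∩ p A B+e ⟩
      ∣ A ∣ + ∣ B+e ∣ ≡⟨ cong (∣ A ∣ +_) (∣translate∣ (p ∸ e) B) ⟩
      ∣ A ∣ + ∣ B ∣ ∎
      where
      open ≡-Reasoning
      ∣B'∣≡∣A∩[B+e]∣ : ∣ B' ∣ ≡ ∣ (λ x → A x ∧ B+e x) ∣
      ∣B'∣≡∣A∩[B+e]∣ = begin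
        ∣ B' ∣ ≡⟨ sym (∣translate∣ (p ∸ e) B') ⟩
        ∣ translate (p ∸ e) B' ∣ ≡⟨ count-cong p (λ x x<p → trans (cong (λ z → B+e x ∧ A z) (+-⊖ x e x<p e<p)) (∧-comm (B+e x) (A x))) ⟩
        ∣ (λ x → A x ∧ B+e x) ∣ ∎

    sumset-shrinks : ∀ x → x < p → (A' ⊕ B') x ≡ true → (A ⊕ B) x ≡ true
    sumset-shrinks x x<p x∈A'+B' with ⊕-elim A' B' x x<p x∈A'+B'
    ... | a' , b' , a'<p , b'<p , A'a' , B'b' , a'+b'≡x with A a' in Aa'
    ...   | true = subst (λ z → (A ⊕ B) z ≡ true) a'+b'≡x (⊕-intro A B a' b' a'<p b'<p Aa' (∧-l B'b'))
    ...   | false = subst (λ z → (A ⊕ B) z ≡ true) same-sum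
            (⊕-intro A B ((b' + e) % p) (a' ⊖ e) (m%n<n _ p) (⊖<p a' e) (∧-r {B b'} B'b') A'a')
      where
      open ≡-Reasoning
      -- a' + b' = (b' + e) + (a' - e)
      same-sum : ((b' + e) % p + a' ⊖ e) % p ≡ x
      same-sum = begin
        ((b' + e) % p + a' ⊖ e) % p ≡⟨ +≋ {(b' + e) % p} {b' + e} {a' ⊖ e} {a' + (p ∸ e)} (%≋ _) (%≋ _) ⟩
        (b' + e + (a' + (p ∸ e))) % p ≡⟨ cong (_% p) (shuffle b' e a' (p ∸ e)) ⟩
        (b' + a' + e + (p ∸ e)) % p ≡⟨ add-then-sub (b' + a') e e<p ⟩
        (b' + a') % p ≡⟨ cong (_% p) (+-comm b' a') ⟩
        (a' + b') % p ≡⟨ a'+b'≡x ⟩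
        x ∎
        where
        shuffle : ∀ u v w z → u + v + (w + z) ≡ u + w + v + z
        shuffle u v w z = begin
          u + v + (w + z) ≡⟨ sym (+-assoc (u + v) w z) ⟩
          u + v + w + z ≡⟨ cong (_+ z) (trans (+-assoc u v w) (trans (cong (u +_) (+-comm v w)) (sym (+-assoc u w v)))) ⟩
          u + w + v + z ∎

    A'-nonempty : 1 ≤ ∣ A ∣ → 1 ≤ ∣ A' ∣
    A'-nonempty 1≤∣A∣ = ≤-trans 1≤∣A∣ (count-mono p (λ x _ Ax → subst (λ z → (z ∨ B+e x) ≡ true) (sym Ax) refl))

    shrinks : ∀ b0 b1 → b0 < p → b1 < p → B b0 ≡ true → B b1 ≡ true →
      translate e A b0 ≡ true → translate e A b1 ≡ false → 1 ≤ ∣ B' ∣ × ∣ B' ∣ < ∣ B ∣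
    shrinks b0 b1 b0<p b1<p Bb0 Bb1 b0+e∈A b1+e∉A = count-wit p B' b0 b0<p (∧-intro Bb0 b0+e∈A) , (begin-strict
      ∣ B' ∣ <⟨ m<m+n ∣ B' ∣ (count-wit p _ b1 b1<p (∧-intro Bb1 (cong not b1+e∉A))) ⟩
      ∣ B' ∣ + ∣ (λ x → B x ∧ not (translate e A x)) ∣ ≡⟨ sym (count-split p B (translate e A)) ⟩
      ∣ B ∣ ∎)
      where open ≤-Reasoning

    transfer : CDBound A' B' → CDBound A B
    transfer (inj₁ full') = inj₁ (≤-trans full' (count-mono p sumset-shrinks))
    transfer (inj₂ bound') = inj₂ (begin
      ∣ A ∣ + ∣ B ∣ ≡⟨ sym size-preserved ⟩
      ∣ A' ∣ + ∣ B' ∣ ≤⟨ bound' ⟩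
      suc ∣ A' ⊕ B' ∣ ≤⟨ s≤s (count-mono p sumset-shrinks) ⟩
      suc ∣ A ⊕ B ∣ ∎)
      where open ≤-Reasoning

  second-element : ∀ B b0 → b0 < p → 2 ≤ ∣ B ∣ → Σ[ b1 ∈ ℕ ] b1 < p × B b1 ≡ true × ¬ b1 ≡ b0
  second-element B b0 b0<p 2≤∣B∣ with count-pos p (λ x → B x ∧ not (x ≡ᵇ b0)) rest-nonempty
    where
    rest-nonempty : 1 ≤ ∣ (λ x → B x ∧ not (x ≡ᵇ b0)) ∣
    rest-nonempty = +-cancelʳ-≤ 1 1 _ (≤-trans 2≤∣B∣ (count-remove p B b0 b0<p))
  ... | b1 , b1<p , Bb1∧b1≢b0 = b1 , b1<p , ∧-l Bb1∧b1≢b0 , distinct (∧-r {B b1} Bb1∧b1≢b0)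
    where
    distinct : not (b1 ≡ᵇ b0) ≡ true → ¬ b1 ≡ b0
    distinct ne refl rewrite ≡ᵇ-refl b1 with ne
    ... | ()

  -- If A + B ≠ ℤ/p and B ≠ ∅, then A is not closed under any nonzero step d:
  -- otherwise A = ℤ/p and hence A + B = ℤ/p.
  escaping-point : ∀ A B b0 d → b0 < p → B b0 ≡ true → 0 < d → d < p → 1 ≤ ∣ A ∣ → ¬ p ≤ ∣ A ⊕ B ∣ →
    Σ[ a ∈ ℕ ] a < p × A a ≡ true × A ((a + d) % p) ≡ false
  escaping-point A B b0 d b0<p Bb0 0<d d<p 1≤∣A∣ not-full
    with exists-below p (λ a → A a ∧ not (A ((a + d) % p))) in found
  ... | false = ⊥-elim (not-full (≤-reflexive (sym (count-all p (A ⊕ B) A⊕B-full))))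
    where
    closed : ∀ a → a < p → A a ≡ true → A ((a + d) % p) ≡ true
    closed a a<p Aa with A ((a + d) % p) in Aa+d
    ... | true = refl
    ... | false with trans (sym found) (exists-below-intro p _ a a<p (∧-intro Aa (cong not Aa+d)))
    ...   | ()
    A-full : ∀ x → x < p → A x ≡ true
    A-full = let a0 , a0<p , Aa0 = count-pos p A 1≤∣A∣ in
             closed-under-step⇒full A a0 d a0<p Aa0 0<d d<p closed
    A⊕B-full : ∀ x → x < p → (A ⊕ B) x ≡ true
    A⊕B-full x _ = exists-below-intro p _ b0 b0<p (∧-intro Bb0 (A-full _ (⊖<p x b0)))
  ... | true with exists-below-elim p _ found
  ...   | a , a<p , escapes = a , a<p , ∧-l escapes , not-true (∧-r {A a} escapes)
    where
    not-true : ∀ {b} → not b ≡ true → b ≡ false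
    not-true {false} _ = refl

  -- The Cauchy–Davenport theorem for the prime p, by induction on |B|: either B is a
  -- singleton, or A + B = ℤ/p, or an e-transform reduces it to a smaller nonempty B.
  cauchy-davenport : ∀ A B → 1 ≤ ∣ A ∣ → 1 ≤ ∣ B ∣ → CDBound A B
  cauchy-davenport A B = <-rec Goal step ∣ B ∣ A B refl
    where
    Goal : ℕ → Set
    Goal n = ∀ A B → ∣ B ∣ ≡ n → 1 ≤ ∣ A ∣ → 1 ≤ ∣ B ∣ → CDBound A B
    step : ∀ n → (∀ {m} → m < n → Goal m) → Goal n
    step n ih A B refl 1≤∣A∣ 1≤∣B∣ with ∣ B ∣ ≤? 1 | p ≤? ∣ A ⊕ B ∣
    ... | yes ∣B∣≤1 | _ = let b , b<p , Bb = count-pos p B 1≤∣B∣ in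
      inj₂ (≤-trans (+-mono-≤ (∣A∣≤∣A⊕B∣ A B b b<p Bb) ∣B∣≤1) (≤-reflexive (+-comm _ 1)))
    ... | no _ | yes full = inj₁ full
    ... | no ∣B∣≰1 | no not-full =
      -- b0 ≠ b1 in B, d = b1 - b0, a ∈ A with a + d ∉ A and e = a - b0: then
      -- b0 + e = a ∈ A but b1 + e = a + d ∉ A, so the e-transform shrinks B
      let b0 , b0<p , Bb0 = count-pos p B 1≤∣B∣
          b1 , b1<p , Bb1 , b1≢b0 = second-element B b0 b0<p (≰⇒> ∣B∣≰1)
          a , a<p , Aa , a+d∉A = escaping-point A B b0 (b1 ⊖ b0) b0<p Bb0 (⊖-nonzero b1 b0 b1<p b0<p b1≢b0)
                                   (⊖<p b1 b0) 1≤∣A∣ not-full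
          open DysonTransform A B (a ⊖ b0) (⊖<p a b0)
          b0+e≡a : (b0 + a ⊖ b0) % p ≡ a
          b0+e≡a = trans (cong (_% p) (+-comm b0 (a ⊖ b0))) (+-⊖ a b0 a<p b0<p)
          1≤∣B'∣ , ∣B'∣<∣B∣ = shrinks b0 b1 b0<p b1<p Bb0 Bb1 (trans (cong A b0+e≡a) Aa)
                                (trans (cong A (+⊖-comm b1 a b0)) a+d∉A)
      in transfer (ih ∣B'∣<∣B∣ A' B' refl (A'-nonempty 1≤∣A∣) 1≤∣B'∣)

module SumsetCorollaries (p : ℕ) .{{_ : NonZero p}} (p-prime : Prime p) where

  open import Data.Nat
  open import Data.Nat.Properties
  open import Data.Nat.DivMod
  open import Data.Bool using (Bool; true; _∧_; not)
  open import Data.Product using (Σ-syntax; _×_; _,_)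
  open import Data.Sum using (inj₁; inj₂)
  open import Relation.Binary.PropositionalEquality
  open import Relation.Nullary using (¬_)
  open import Data.Nat.Tactic.RingSolver using (solve-∀)
  open Counting
  open Residues p
  open SumSets p
  open CauchyDavenport p p-prime

  sumset-full : ∀ A B → 1 ≤ ∣ A ∣ → 1 ≤ ∣ B ∣ → suc p ≤ ∣ A ∣ + ∣ B ∣ → ∀ x → x < p → (A ⊕ B) x ≡ true
  sumset-full A B 1≤∣A∣ 1≤∣B∣ big = count-full p (A ⊕ B) (bound (cauchy-davenport A B 1≤∣A∣ 1≤∣B∣))
    where
    bound : CDBound A B → p ≤ ∣ A ⊕ B ∣
    bound (inj₁ full) = full
    bound (inj₂ cd) = ≤-pred (≤-trans big cd)

  three-term-sums : ∀ A B C → 1 ≤ ∣ A ∣ → 1 ≤ ∣ B ∣ → 1 ≤ ∣ C ∣ → p + 2 ≤ ∣ A ∣ + ∣ B ∣ + ∣ C ∣ →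
    ∀ t → t < p → Σ[ a ∈ ℕ ] Σ[ b ∈ ℕ ] Σ[ c ∈ ℕ ] A a ≡ true × B b ≡ true × C c ≡ true × (a + b + c) % p ≡ t
  three-term-sums A B C 1≤∣A∣ 1≤∣B∣ 1≤∣C∣ big t t<p
    with ⊕-elim (A ⊕ B) C t t<p (sumset-full (A ⊕ B) C 1≤∣A⊕B∣ 1≤∣C∣ big' t t<p)
    where
    1≤∣A⊕B∣ : 1 ≤ ∣ A ⊕ B ∣
    1≤∣A⊕B∣ = let b , b<p , Bb = count-pos p B 1≤∣B∣ in ≤-trans 1≤∣A∣ (∣A∣≤∣A⊕B∣ A B b b<p Bb)
    big' : suc p ≤ ∣ A ⊕ B ∣ + ∣ C ∣
    big' with cauchy-davenport A B 1≤∣A∣ 1≤∣B∣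
    ... | inj₁ full = subst (_≤ ∣ A ⊕ B ∣ + ∣ C ∣) (+-comm p 1) (+-mono-≤ full 1≤∣C∣)
    ... | inj₂ cd = ≤-pred (begin
        suc (suc p) ≡⟨ +-comm 2 p ⟩
        p + 2 ≤⟨ big ⟩
        ∣ A ∣ + ∣ B ∣ + ∣ C ∣ ≤⟨ +-monoˡ-≤ ∣ C ∣ cd ⟩
        suc (∣ A ⊕ B ∣ + ∣ C ∣) ∎)
      where open ≤-Reasoning
  ... | x , c , x<p , _ , x∈A+B , Cc , x+c≡t with ⊕-elim A B x x<p x∈A+B
  ...   | a , b , _ , _ , Aa , Bb , a+b≡x = a , b , c , Aa , Bb , Cc , (begin
          (a + b + c) % p ≡⟨ +≋ {a + b} {(a + b) % p} {c} (sym (%≋ _)) refl ⟩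
          ((a + b) % p + c) % p ≡⟨ cong (λ z → (z + c) % p) a+b≡x ⟩
          (x + c) % p ≡⟨ x+c≡t ⟩
          t ∎)
    where open ≡-Reasoning

  halve : ∀ h → p ≡ suc (h + h) → ∀ b s → b < p → (b + b) % p ≡ s → b ≡ (s * suc h) % p
  halve h p≡2h+1 b s b<p 2b≡s = ≋⇒≡ b<p (m%n<n _ p) (begin
    b % p ≡⟨ sym ([m+kn]%n≡m%n b b p) ⟩
    (b + b * p) % p ≡⟨ cong (λ z → (b + b * z) % p) p≡2h+1 ⟩
    (b + b * suc (h + h)) % p ≡⟨ cong (_% p) (double-times-half b h) ⟩
    ((b + b) * suc h) % p ≡⟨ *≋ {b + b} {s} {suc h} (trans (sym (%≋ (b + b))) (cong (_% p) 2b≡s)) refl ⟩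
    (s * suc h) % p ≡⟨ sym (%≋ _) ⟩
    (s * suc h) % p % p ∎)
    where
    open ≡-Reasoning
    double-times-half : ∀ b h → b + b * suc (h + h) ≡ (b + b) * suc h
    double-times-half = solve-∀

  private
    positive : ∀ {m k} → suc k ≤ m + m → 1 ≤ m
    positive {suc m} _ = s≤s z≤n

    ≢ᵇ⇒≢ : ∀ {x v} → not (x ≡ᵇ v) ≡ true → ¬ x ≡ v
    ≢ᵇ⇒≢ {x} ne refl rewrite ≡ᵇ-refl x with ne
    ... | ()

  two-term-sums : ∀ B → suc p ≤ ∣ B ∣ + ∣ B ∣ → ∀ s → s < p →
    Σ[ b ∈ ℕ ] Σ[ c ∈ ℕ ] b < p × B b ≡ true × B c ≡ true × (b + c) % p ≡ s
  two-term-sums B big s s<p =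
    let b , c , b<p , _ , Bb , Bc , b+c≡s = ⊕-elim B B s s<p (sumset-full B B (positive big) (positive big) big s s<p)
    in b , c , b<p , Bb , Bc , b+c≡s

  remove-two : ∀ A a u → a < p → u < p → p + 5 ≤ ∣ A ∣ + ∣ A ∣ →
    suc p ≤ ∣ (λ x → (A x ∧ not (x ≡ᵇ a)) ∧ not (x ≡ᵇ u)) ∣ + ∣ (λ x → (A x ∧ not (x ≡ᵇ a)) ∧ not (x ≡ᵇ u)) ∣
  remove-two A a u a<p u<p big = +-cancelʳ-≤ 4 (suc p) (∣ B ∣ + ∣ B ∣) (begin
    suc p + 4 ≡⟨ +-comm (suc p) 4 ⟩
    5 + p ≡⟨ +-comm 5 p ⟩
    p + 5 ≤⟨ big ⟩
    ∣ A ∣ + ∣ A ∣ ≤⟨ +-mono-≤ ∣A∣≤∣B∣+2 ∣A∣≤∣B∣+2 ⟩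
    ∣ B ∣ + 2 + (∣ B ∣ + 2) ≡⟨ regroup ∣ B ∣ ⟩
    ∣ B ∣ + ∣ B ∣ + 4 ∎)
    where
    open ≤-Reasoning
    A-a B : ℕ → Bool
    A-a x = A x ∧ not (x ≡ᵇ a)
    B x = A-a x ∧ not (x ≡ᵇ u)
    ∣A∣≤∣B∣+2 : ∣ A ∣ ≤ ∣ B ∣ + 2
    ∣A∣≤∣B∣+2 = ≤-trans (count-remove p A a a<p)
      (≤-trans (+-monoˡ-≤ 1 (count-remove p A-a u u<p)) (≤-reflexive (+-assoc ∣ B ∣ 1 1)))
    regroup : ∀ m → m + 2 + (m + 2) ≡ m + m + 4
    regroup = solve-∀

  -- If |A| ≥ (p + 5)/2, every residue t is a sum of three distinct elements of A:
  -- fix a ∈ A, discard a and the unique u with 2u ≡ t - a, and write t - a = b + c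
  -- with b, c in the remaining set B, which has |B| ≥ (p + 1)/2 so that B + B = ℤ/p.
  distinct-three-term-sums : ∀ h → p ≡ suc (h + h) → ∀ A → p + 5 ≤ ∣ A ∣ + ∣ A ∣ → ∀ t → t < p →
    Σ[ a ∈ ℕ ] Σ[ b ∈ ℕ ] Σ[ c ∈ ℕ ] A a ≡ true × A b ≡ true × A c ≡ true ×
      ¬ a ≡ b × ¬ a ≡ c × ¬ b ≡ c × (a + b + c) % p ≡ t
  distinct-three-term-sums h p≡2h+1 A big t t<p =
    let a , a<p , Aa = count-pos p A (positive (subst (_≤ ∣ A ∣ + ∣ A ∣) (+-comm p 5) big))
        s = t ⊖ a
        u = (s * suc h) % p
        b , c , b<p , Bb , Bc , b+c≡s =
          two-term-sums (λ x → (A x ∧ not (x ≡ᵇ a)) ∧ not (x ≡ᵇ u)) (remove-two A a u a<p (m%n<n _ p) big) s (⊖<p t a)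
        b≢c : ¬ b ≡ c
        b≢c b≡c = ≢ᵇ⇒≢ (∧-r {A b ∧ not (b ≡ᵇ a)} Bb) (halve h p≡2h+1 b s b<p (subst (λ z → (b + z) % p ≡ s) (sym b≡c) b+c≡s))
    in a , b , c , Aa , ∧-l (∧-l Bb) , ∧-l (∧-l Bc) , (λ a≡b → ≢ᵇ⇒≢ (∧-r {A b} (∧-l Bb)) (sym a≡b)) ,
       (λ a≡c → ≢ᵇ⇒≢ (∧-r {A c} (∧-l Bc)) (sym a≡c)) , b≢c , ⊖-split a b c t a<p t<p b+c≡s

module AffinePlane where

  open import Data.Nat
  open import Data.Nat.Properties
  open import Data.Nat.DivMod using (_/_; _%_)
  open import Data.Nat.Divisibility using (_∣_; _∣?_)
  open import Data.Bool using (Bool; true; false; _∧_; _∨_; not; if_then_else_; T)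
  open import Data.Product using (_×_; _,_)
  open import Data.List using (List; []; _∷_; length; filterᵇ; map; _++_)
  open import Data.Bool.ListAction using (all)
  open import Data.List.Relation.Unary.All as All using (All; []; _∷_)
  open import Data.List.Relation.Unary.Any using (here; there)
  open import Data.List.Membership.Propositional using (_∈_)
  open import Data.List.Membership.Propositional.Properties using (∈-filter⁻; ∈-map⁺; ∈-++⁺ˡ; ∈-++⁺ʳ)
  open import Data.Vec using (Vec; []; _∷_)
  open import Relation.Binary.PropositionalEquality
  open import Relation.Nullary using (¬_; yes; no; Dec; ¬?)
  open import Relation.Nullary.Decidable using (T?; toWitness; _×-dec_)
  open import Data.Nat.Tactic.RingSolver using (solve-∀)
  open Counting using (sumBelow; sumBelow-cong; sumBelow-+; ≡ᵇ-refl; ≢⇒≡ᵇfalse)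

  -- The affine plane AG(2,3) = (ℤ/3)², with the point (a, r) labelled 3a + r ∈ [0,9).
  Line : Set
  Line = ℕ × ℕ × ℕ

  lines : List Line
  lines = (0 , 1 , 2) ∷ (0 , 3 , 6) ∷ (0 , 4 , 8) ∷ (0 , 5 , 7) ∷ (1 , 3 , 8) ∷ (1 , 4 , 7) ∷
          (1 , 5 , 6) ∷ (2 , 3 , 7) ∷ (2 , 4 , 6) ∷ (2 , 5 , 8) ∷ (3 , 4 , 5) ∷ (6 , 7 , 8) ∷ []

  ZeroSumTriple : Line → Set
  ZeroSumTriple (i , j , k) = 3 ∣ (i / 3 + j / 3 + k / 3) × 3 ∣ (i % 3 + j % 3 + k % 3) × ¬ i ≡ j × ¬ i ≡ k × ¬ j ≡ k

  lines-zero-sum : All ZeroSumTriple lines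
  lines-zero-sum = toWitness {a? = All.all? zero-sum? lines} _
    where
    zero-sum? : ∀ L → Dec (ZeroSumTriple L)
    zero-sum? (i , j , k) = 3 ∣? (i / 3 + j / 3 + k / 3) ×-dec 3 ∣? (i % 3 + j % 3 + k % 3) ×-dec
                            ¬? (i ≟ j) ×-dec ¬? (i ≟ k) ×-dec ¬? (j ≟ k)

  InPlane : Line → Set
  InPlane (i , j , k) = i < 9 × j < 9 × k < 9

  lines-in-plane : All InPlane lines
  lines-in-plane = toWitness {a? = All.all? (λ (i , j , k) → i <? 9 ×-dec j <? 9 ×-dec k <? 9) lines} _

  δ : ℕ → ℕ → ℕ
  δ i x = if x ≡ᵇ i then 1 else 0

  incidence : Line → ℕ → ℕ
  incidence (i , j , k) x = δ i x + δ j x + δ k x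

  sumBelow-δ : ∀ N i (f : ℕ → ℕ) → i < N → sumBelow N (λ x → δ i x * f x) ≡ f i
  sumBelow-δ (suc N) i f i<N with N ≟ i
  ... | yes refl rewrite ≡ᵇ-refl N =
    trans (cong (f N + 0 +_) (trans (sumBelow-cong N vanish) (sumBelow-zero N)))
          (trans (+-identityʳ _) (+-identityʳ _))
    where
    vanish : ∀ x → x < N → δ N x * f x ≡ 0
    vanish x x<N rewrite ≢⇒≡ᵇfalse x N (λ e → <-irrefl e x<N) = refl
    sumBelow-zero : ∀ M → sumBelow M (λ _ → 0) ≡ 0
    sumBelow-zero zero = refl
    sumBelow-zero (suc M) = sumBelow-zero M
  ... | no N≢i rewrite ≢⇒≡ᵇfalse N i N≢i = sumBelow-δ N i f (≤∧≢⇒< (≤-pred i<N) (λ e → N≢i (sym e)))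

  lineSum : (ℕ → ℕ) → Line → ℕ
  lineSum n (i , j , k) = n i + n j + n k

  linesSum : (ℕ → ℕ) → List Line → ℕ
  linesSum n [] = 0
  linesSum n (L ∷ Ls) = lineSum n L + linesSum n Ls

  degree : List Line → ℕ → ℕ
  degree [] x = 0
  degree (L ∷ Ls) x = incidence L x + degree Ls x

  double-counting : ∀ (n : ℕ → ℕ) Ls → All InPlane Ls → linesSum n Ls ≡ sumBelow 9 (λ x → degree Ls x * n x)
  double-counting n [] [] = refl
  double-counting n (L@(i , j , k) ∷ Ls) ((i<9 , j<9 , k<9) ∷ in-plane) = begin
    lineSum n L + linesSum n Ls
      ≡⟨ cong₂ _+_ (sym single-line) (double-counting n Ls in-plane) ⟩
    sumBelow 9 (λ x → incidence L x * n x) + sumBelow 9 (λ x → degree Ls x * n x)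
      ≡⟨ sym (sumBelow-+ 9 (λ x → incidence L x * n x) (λ x → degree Ls x * n x)) ⟩
    sumBelow 9 (λ x → incidence L x * n x + degree Ls x * n x)
      ≡⟨ sumBelow-cong 9 (λ x _ → sym (*-distribʳ-+ (n x) (incidence L x) (degree Ls x))) ⟩
    sumBelow 9 (λ x → degree (L ∷ Ls) x * n x) ∎
    where
    open ≡-Reasoning
    δn : ℕ → ℕ → ℕ
    δn i x = δ i x * n x
    single-line : sumBelow 9 (λ x → incidence L x * n x) ≡ lineSum n L
    single-line = begin
      sumBelow 9 (λ x → incidence L x * n x)
        ≡⟨ sumBelow-cong 9 (λ x _ → expand (δ i x) (δ j x) (δ k x) (n x)) ⟩
      sumBelow 9 (λ x → δn i x + δn j x + δn k x)
        ≡⟨ sumBelow-+ 9 (λ x → δn i x + δn j x) (δn k) ⟩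
      sumBelow 9 (λ x → δn i x + δn j x) + sumBelow 9 (δn k)
        ≡⟨ cong (_+ sumBelow 9 (δn k)) (sumBelow-+ 9 (δn i) (δn j)) ⟩
      sumBelow 9 (δn i) + sumBelow 9 (δn j) + sumBelow 9 (δn k)
        ≡⟨ cong₂ _+_ (cong₂ _+_ (sumBelow-δ 9 i n i<9) (sumBelow-δ 9 j n j<9)) (sumBelow-δ 9 k n k<9) ⟩
      n i + n j + n k ∎
      where
      expand : ∀ a b c m → (a + b + c) * m ≡ a * m + b * m + c * m
      expand = solve-∀

  -- Zero patterns: Z ∈ Bool⁹ marks the points of weight zero.
  _at_ : ∀ {k} → Vec Bool k → ℕ → Bool
  [] at _ = false
  (b ∷ v) at zero = b
  (b ∷ v) at suc x = v at x

  nonempty : ∀ {k} → Vec Bool k → Bool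
  nonempty [] = false
  nonempty (b ∷ v) = b ∨ nonempty v

  avoids : Vec Bool 9 → Line → Bool
  avoids Z (i , j , k) = not (Z at i ∨ Z at j ∨ Z at k)

  avoiding : Vec Bool 9 → List Line
  avoiding Z = filterᵇ (avoids Z) lines

  ∈-avoiding : ∀ Z {L} → L ∈ avoiding Z → L ∈ lines × T (avoids Z L)
  ∈-avoiding Z = ∈-filter⁻ (λ L → T? (avoids Z L))

  -- A certificate for a zero pattern Z is a multiplicity D for the lines avoiding Z;
  -- the points outside Z lying on fewer than D of them have total deficit K.
  deficit : Vec Bool 9 → ℕ → ℕ → ℕ
  deficit Z D x = if Z at x then 0 else D ∸ degree (avoiding Z) x

  totalDeficit : Vec Bool 9 → ℕ → ℕ
  totalDeficit Z D = sumBelow 9 (deficit Z D)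

  -- The two linear conditions making D a certificate (see `certified-bound-impossible`).
  certifies : Vec Bool 9 → ℕ → Bool
  certifies Z D = (K + 2 * ℓ + 1 ≤ᵇ 6 * D) ∧ (K + 1 ≤ᵇ 3 * (6 * D ∸ (K + 2 * ℓ)))
    where
    K = totalDeficit Z D
    ℓ = length (avoiding Z)

  multiplicity : Vec Bool 9 → ℕ
  multiplicity Z = if certifies Z 1 then 1 else (if certifies Z 2 then 2 else 3)

  vectors : ∀ k → List (Vec Bool k)
  vectors zero = [] ∷ []
  vectors (suc k) = map (true ∷_) (vectors k) ++ map (false ∷_) (vectors k)

  ∈-vectors : ∀ {k} (v : Vec Bool k) → v ∈ vectors k
  ∈-vectors [] = here refl
  ∈-vectors {suc k} (true ∷ v) = ∈-++⁺ˡ (∈-map⁺ (true ∷_) (∈-vectors v))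
  ∈-vectors {suc k} (false ∷ v) = ∈-++⁺ʳ (map (true ∷_) (vectors k)) (∈-map⁺ (false ∷_) (∈-vectors v))

  all-sound : ∀ {A : Set} (f : A → Bool) {x} xs → all f xs ≡ true → x ∈ xs → f x ≡ true
  all-sound f (y ∷ ys) ok (here refl) with f y | ok
  ... | true | _ = refl
  all-sound f (y ∷ ys) ok (there x∈ys) with f y | ok
  ... | true | ok' = all-sound f ys ok' x∈ys

  certified : Vec Bool 9 → Bool
  certified Z = not (nonempty Z) ∨ certifies Z (multiplicity Z)

  all-certified : all certified (vectors 9) ≡ true
  all-certified = refl

  certificate : ∀ Z → nonempty Z ≡ true → certifies Z (multiplicity Z) ≡ true
  certificate Z Z≠∅ = use Z≠∅ (all-sound certified (vectors 9) all-certified (∈-vectors Z))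
    where
    use : ∀ {b c} → b ≡ true → (not b ∨ c) ≡ true → c ≡ true
    use refl ok = ok

module HeavyLine where

  open import Data.Nat
  open import Data.Nat.Properties
  open import Data.Bool using (Bool; true; false; _∧_; _∨_; not; T)
  open import Data.Product using (Σ-syntax; _×_; _,_; proj₁)
  open import Data.List using (List; []; _∷_; length)
  open import Data.List.Relation.Unary.All as All using (All; []; _∷_)
  open import Data.List.Relation.Unary.All.Properties using (¬All⇒Any¬)
  open import Data.List.Membership.Propositional using (_∈_; find)
  open import Data.Vec using (Vec; []; _∷_)
  open import Data.Empty using (⊥; ⊥-elim)
  open import Relation.Binary.PropositionalEquality
  open import Relation.Nullary using (¬_; yes; no)
  open import Data.Nat.Tactic.RingSolver using (solve-∀)
  open AffinePlane
  open Counting using (sumBelow; sumBelow-cong; sumBelow-mono; sumBelow-+; sumBelow-*ʳ; ∧-l; ∧-r)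

  table : ∀ k → (ℕ → Bool) → Vec Bool k
  table zero f = []
  table (suc k) f = f 0 ∷ table k (λ x → f (suc x))

  at-table : ∀ k f x → x < k → table k f at x ≡ f x
  at-table (suc k) f zero _ = refl
  at-table (suc k) f (suc x) x<k = at-table k (λ y → f (suc y)) x (≤-pred x<k)

  at⇒nonempty : ∀ {k} (v : Vec Bool k) x → v at x ≡ true → nonempty v ≡ true
  at⇒nonempty (b ∷ v) zero b≡true rewrite b≡true = refl
  at⇒nonempty (true ∷ v) (suc x) _ = refl
  at⇒nonempty (false ∷ v) (suc x) v[x] = at⇒nonempty v x v[x]

  none-of : ∀ a b c → T (not (a ∨ b ∨ c)) → a ≡ false × b ≡ false × c ≡ false
  none-of false false false _ = refl , refl , refl

  certified-bound-impossible : ∀ D K ℓ h → 2 ≤ h → K + 2 * ℓ + 1 ≤ 6 * D → K + 1 ≤ 3 * (6 * D ∸ (K + 2 * ℓ)) →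
    D * (6 * h + 6) ≤ ℓ * (2 * h + 2) + K * (h + 2) → ⊥
  certified-bound-impossible D K ℓ h 2≤h cond₁ cond₂ bound =
    <-irrefl refl (≤-trans (subst (_≤ 3 * a) (+-comm K 1) cond₂) (≤-trans 3a≤a[h+1] a[h+1]≤K))
    where
    X = K + 2 * ℓ
    a = 6 * D ∸ X
    6D≡a+X : 6 * D ≡ a + X
    6D≡a+X = sym (m∸n+n≡m (≤-trans (m≤m+n X 1) cond₁))
    -- expanding both sides of the bound and cancelling X (h + 1) leaves a (h + 1) ≤ K
    a[h+1]≤K : a * (h + 1) ≤ K
    a[h+1]≤K = +-cancelʳ-≤ (X * (h + 1)) _ _ (begin
      a * (h + 1) + X * (h + 1) ≡⟨ sym (*-distribʳ-+ (h + 1) a X) ⟩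
      (a + X) * (h + 1) ≡⟨ cong (_* (h + 1)) (sym 6D≡a+X) ⟩
      6 * D * (h + 1) ≡⟨ lhs D h ⟩
      D * (6 * h + 6) ≤⟨ bound ⟩
      ℓ * (2 * h + 2) + K * (h + 2) ≡⟨ rhs K ℓ h ⟩
      K + X * (h + 1) ∎)
      where
      open ≤-Reasoning
      lhs : ∀ D h → 6 * D * (h + 1) ≡ D * (6 * h + 6)
      lhs = solve-∀
      rhs : ∀ K ℓ h → ℓ * (2 * h + 2) + K * (h + 2) ≡ K + (K + 2 * ℓ) * (h + 1)
      rhs = solve-∀
    3a≤a[h+1] : 3 * a ≤ a * (h + 1)
    3a≤a[h+1] = subst (_≤ a * (h + 1)) (*-comm a 3) (*-monoʳ-≤ a (+-monoˡ-≤ 1 2≤h))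

  module Weighting (h : ℕ) (n : ℕ → ℕ) (cap : ∀ x → x < 9 → n x ≤ h + 2) (total : sumBelow 9 n ≡ 6 * h + 6) where

    Z : Vec Bool 9
    Z = table 9 (λ x → n x ≡ᵇ 0)

    Z-spec : ∀ x → x < 9 → Z at x ≡ (n x ≡ᵇ 0)
    Z-spec = at-table 9 (λ x → n x ≡ᵇ 0)

    -- If no line missing the zeros of n is heavier than 2h + 2, then for every
    -- multiplicity D, counting each point D times gives D (6h + 6) ≤ ℓ (2h + 2) + K (h + 2).
    light-lines-bound : All (λ L → lineSum n L ≤ 2 * h + 2) (avoiding Z) → ∀ D →
      D * (6 * h + 6) ≤ length (avoiding Z) * (2 * h + 2) + totalDeficit Z D * (h + 2)
    light-lines-bound light D = begin
      D * (6 * h + 6) ≡⟨ cong (D *_) (sym total) ⟩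
      D * sumBelow 9 n ≡⟨ *-comm D _ ⟩
      sumBelow 9 n * D ≡⟨ sym (sumBelow-*ʳ 9 n D) ⟩
      sumBelow 9 (λ x → n x * D) ≡⟨ sumBelow-cong 9 (λ x _ → *-comm (n x) D) ⟩
      sumBelow 9 (λ x → D * n x) ≤⟨ sumBelow-mono 9 covered ⟩
      sumBelow 9 (λ x → deg x * n x + deficit Z D x * n x) ≡⟨ sumBelow-+ 9 (λ x → deg x * n x) (λ x → deficit Z D x * n x) ⟩
      sumBelow 9 (λ x → deg x * n x) + sumBelow 9 (λ x → deficit Z D x * n x)
        ≤⟨ +-mono-≤ (≤-trans (≤-reflexive (sym lines≡)) (lines≤ light)) deficits≤ ⟩
      length (avoiding Z) * (2 * h + 2) + totalDeficit Z D * (h + 2) ∎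
      where
      open ≤-Reasoning
      deg = degree (avoiding Z)
      avoiding-in-plane : All InPlane (avoiding Z)
      avoiding-in-plane = All.tabulate (λ L∈ → All.lookup lines-in-plane (proj₁ (∈-avoiding Z L∈)))
      lines≡ : linesSum n (avoiding Z) ≡ sumBelow 9 (λ x → deg x * n x)
      lines≡ = double-counting n (avoiding Z) avoiding-in-plane
      lines≤ : ∀ {Ls} → All (λ L → lineSum n L ≤ 2 * h + 2) Ls → linesSum n Ls ≤ length Ls * (2 * h + 2)
      lines≤ [] = z≤n
      lines≤ (L≤ ∷ Ls≤) = +-mono-≤ L≤ (lines≤ Ls≤)
      covered : ∀ x → x < 9 → D * n x ≤ deg x * n x + deficit Z D x * n x
      covered x x<9 with Z at x in Zx
      ... | true = ≤-trans (≤-reflexive (trans (cong (D *_) (n≡0 (trans (sym (Z-spec x x<9)) Zx))) (*-zeroʳ D))) z≤n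
        where
        n≡0 : ∀ {m} → (m ≡ᵇ 0) ≡ true → m ≡ 0
        n≡0 {zero} _ = refl
      ... | false = begin
        D * n x ≤⟨ *-monoˡ-≤ (n x) (m≤n+m∸n D (deg x)) ⟩
        (deg x + (D ∸ deg x)) * n x ≡⟨ *-distribʳ-+ (n x) (deg x) _ ⟩
        deg x * n x + (D ∸ deg x) * n x ∎
      deficits≤ : sumBelow 9 (λ x → deficit Z D x * n x) ≤ totalDeficit Z D * (h + 2)
      deficits≤ = begin
        sumBelow 9 (λ x → deficit Z D x * n x) ≤⟨ sumBelow-mono 9 (λ x x<9 → *-monoʳ-≤ (deficit Z D x) (cap x x<9)) ⟩
        sumBelow 9 (λ x → deficit Z D x * (h + 2)) ≡⟨ sumBelow-*ʳ 9 (deficit Z D) (h + 2) ⟩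
        totalDeficit Z D * (h + 2) ∎

    positive : ∀ x → x < 9 → Z at x ≡ false → 1 ≤ n x
    positive x x<9 Zx with n x | Z-spec x x<9
    ... | suc _ | _ = s≤s z≤n
    ... | zero | Zx≡true with trans (sym Zx) Zx≡true
    ...   | ()

    -- The combinatorial core: if moreover h ≥ 2 and n has a zero, some line avoiding the
    -- zeros of n has weight at least 2h + 3.  Otherwise all such lines are light, and
    -- `light-lines-bound` for the certified multiplicity of Z contradicts the certificate.
    heavy-line : 2 ≤ h → ∀ m → m < 9 → n m ≡ 0 →
      Σ[ i ∈ ℕ ] Σ[ j ∈ ℕ ] Σ[ k ∈ ℕ ] (i , j , k) ∈ lines × 1 ≤ n i × 1 ≤ n j × 1 ≤ n k × 2 * h + 3 ≤ n i + n j + n k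
    heavy-line 2≤h m m<9 n[m]≡0 with All.all? (λ L → lineSum n L ≤? 2 * h + 2) (avoiding Z)
    ... | yes light = ⊥-elim (certified-bound-impossible D K ℓ h 2≤h cond₁ cond₂ (light-lines-bound light D))
      where
      Z≠∅ : nonempty Z ≡ true
      Z≠∅ = at⇒nonempty Z m (trans (Z-spec m m<9) (cong (_≡ᵇ 0) n[m]≡0))
      D = multiplicity Z
      K = totalDeficit Z D
      ℓ = length (avoiding Z)
      cert : certifies Z D ≡ true
      cert = certificate Z Z≠∅
      cond₁ : K + 2 * ℓ + 1 ≤ 6 * D
      cond₁ = ≤ᵇ⇒≤ _ _ (subst T (sym (∧-l cert)) _)
      cond₂ : K + 1 ≤ 3 * (6 * D ∸ (K + 2 * ℓ))
      cond₂ = ≤ᵇ⇒≤ _ _ (subst T (sym (∧-r {K + 2 * ℓ + 1 ≤ᵇ 6 * D} cert)) _)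
    ... | no heavy with find (¬All⇒Any¬ (λ L → lineSum n L ≤? 2 * h + 2) (avoiding Z) heavy)
    ...   | (i , j , k) , L∈ , L≰ with ∈-avoiding Z L∈
    ...     | L∈lines , misses with All.lookup lines-in-plane L∈lines | none-of (Z at i) (Z at j) (Z at k) misses
    ...       | i<9 , j<9 , k<9 | Zi , Zj , Zk =
      i , j , k , L∈lines , positive i i<9 Zi , positive j j<9 Zj , positive k k<9 Zk , subst (_≤ n i + n j + n k) (sym (+-suc (2 * h) 2)) (≰⇒> L≰)

module Sequences where

  open import Data.Nat
  open import Data.Nat.Properties
  open import Data.Nat.DivMod
  open import Data.Nat.Divisibility using (_∣_; divides)
  open import Data.Nat.ListAction using (sum)
  open import Data.Bool using (Bool; true; false; _∧_; _∨_)
  open import Data.Bool.ListAction using (any)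
  open import Data.Product using (Σ-syntax; _×_; _,_)
  open import Data.List using (List; []; _∷_; length; map)
  open import Data.List.Relation.Unary.All using (All; []; _∷_)
  open import Data.List.Relation.Unary.Any using (here; there)
  open import Data.List.Membership.Propositional using (_∈_)
  open import Data.List.Relation.Unary.Unique.Propositional using (Unique)
  open import Data.List.Relation.Unary.AllPairs using ([]; _∷_)
  open import Data.List.Relation.Binary.Sublist.Propositional using (_⊆_; _∷_; _∷ʳ_; ⊆-refl; ⊆-trans)
  open import Data.Empty using (⊥-elim)
  open import Relation.Binary.PropositionalEquality
  open import Relation.Nullary using (¬_)
  open Counting

  div-mod-unique : ∀ m a b c d → b < m → d < m → a * m + b ≡ c * m + d → a ≡ c × b ≡ d
  div-mod-unique m zero b zero d b<m d<m e = refl , e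
  div-mod-unique m zero b (suc c) d b<m d<m e =
    ⊥-elim (<-irrefl refl (≤-trans b<m (subst (m ≤_) (sym e) (≤-trans (m≤m+n m (c * m)) (m≤m+n _ d)))))
  div-mod-unique m (suc a) b zero d b<m d<m e =
    ⊥-elim (<-irrefl refl (≤-trans d<m (subst (m ≤_) e (≤-trans (m≤m+n m (a * m)) (m≤m+n _ b)))))
  div-mod-unique m (suc a) b (suc c) d b<m d<m e with div-mod-unique m a b c d b<m d<m
    (+-cancelˡ-≡ m _ _ (trans (sym (+-assoc m (a * m) b)) (trans e (+-assoc m (c * m) d))))
  ... | refl , b≡d = refl , b≡d

  %-equal⇒∣∸ : ∀ m u v .{{_ : NonZero m}} → u % m ≡ v % m → m ∣ (u ∸ v)
  %-equal⇒∣∸ m u v e = divides (u / m ∸ v / m) (begin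
    u ∸ v ≡⟨ cong₂ _∸_ (m≡m%n+[m/n]*n u m) (m≡m%n+[m/n]*n v m) ⟩
    (u % m + u / m * m) ∸ (v % m + v / m * m) ≡⟨ cong (λ z → (z + u / m * m) ∸ (v % m + v / m * m)) e ⟩
    (v % m + u / m * m) ∸ (v % m + v / m * m) ≡⟨ [m+n]∸[m+o]≡n∸o (v % m) _ _ ⟩
    u / m * m ∸ v / m * m ≡⟨ sym (*-distribʳ-∸ m (u / m) (v / m)) ⟩
    (u / m ∸ v / m) * m ∎)
    where open ≡-Reasoning

  module _ {A : Set} where

    sum-map-% : ∀ m .{{_ : NonZero m}} (L : List A) (f f' : A → ℕ) → (∀ g → f g % m ≡ f' g % m) →
      sum (map f L) % m ≡ sum (map f' L) % m
    sum-map-% m [] f f' _ = refl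
    sum-map-% m (g ∷ L) f f' f≡f' = begin
      (f g + sum (map f L)) % m ≡⟨ %-distribˡ-+ (f g) _ m ⟩
      (f g % m + sum (map f L) % m) % m ≡⟨ cong₂ (λ u v → (u + v) % m) (f≡f' g) (sum-map-% m L f f' f≡f') ⟩
      (f' g % m + sum (map f' L) % m) % m ≡⟨ sym (%-distribˡ-+ (f' g) _ m) ⟩
      (f' g + sum (map f' L)) % m ∎
      where open ≡-Reasoning

    any-intro : ∀ {xs x} (f : A → Bool) → x ∈ xs → f x ≡ true → any f xs ≡ true
    any-intro f (here refl) fx rewrite fx = refl
    any-intro {y ∷ xs} f (there x∈xs) fx with f y
    ... | true = refl
    ... | false = any-intro f x∈xs fx

    any-elim : ∀ xs (f : A → Bool) → any f xs ≡ true → Σ[ x ∈ A ] x ∈ xs × f x ≡ true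
    any-elim (x ∷ xs) f found with f x in fx
    ... | true = x , here refl , fx
    ... | false with any-elim xs f found
    ...   | y , y∈xs , fy = y , there y∈xs , fy

    any-cong : ∀ xs {f f' : A → Bool} → (∀ x → f x ≡ f' x) → any f xs ≡ any f' xs
    any-cong [] _ = refl
    any-cong (x ∷ xs) f≡f' = cong₂ _∨_ (f≡f' x) (any-cong xs f≡f')

    count-codes : ∀ (code : A → ℕ) M (S : List A) → Unique S → (∀ g → code g < M) →
      (∀ g g' → code g ≡ code g' → g ≡ g') → count M (λ i → any (λ g → code g ≡ᵇ i) S) ≡ length S
    count-codes code M [] _ _ _ = count-none M _ (λ _ _ → refl)
    count-codes code M (g ∷ S) (g∉S ∷ unique) bounded injective = begin
      count M (λ i → (code g ≡ᵇ i) ∨ hit i)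
        ≡⟨ sym (+-identityʳ _) ⟩
      count M (λ i → (code g ≡ᵇ i) ∨ hit i) + 0
        ≡⟨ cong (count M (λ i → (code g ≡ᵇ i) ∨ hit i) +_) (sym disjoint) ⟩
      count M (λ i → (code g ≡ᵇ i) ∨ hit i) + count M (λ i → (code g ≡ᵇ i) ∧ hit i)
        ≡⟨ count-∪∩ M (λ i → code g ≡ᵇ i) hit ⟩
      count M (λ i → code g ≡ᵇ i) + count M hit
        ≡⟨ cong₂ _+_ one (count-codes code M S unique bounded injective) ⟩
      suc (length S) ∎
      where
      open ≡-Reasoning
      hit : ℕ → Bool
      hit i = any (λ g → code g ≡ᵇ i) S
      one : count M (λ i → code g ≡ᵇ i) ≡ 1
      one = trans (count-cong M (λ i _ → ≡ᵇ-sym (code g) i)) (count-singleton M (code g) (bounded g))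
      code-g-new : ∀ {S'} → All (λ y → ¬ g ≡ y) S' → any (λ g' → code g' ≡ᵇ code g) S' ≡ false
      code-g-new [] = refl
      code-g-new {y ∷ S'} (g≢y ∷ rest) with code y ≡ᵇ code g in e
      ... | true = ⊥-elim (g≢y (sym (injective y g (≡ᵇtrue⇒≡ _ _ e))))
      ... | false = code-g-new rest
      disjoint : count M (λ i → (code g ≡ᵇ i) ∧ hit i) ≡ 0
      disjoint = count-none M _ miss
        where
        miss : ∀ i → i < M → ((code g ≡ᵇ i) ∧ hit i) ≡ false
        miss i _ with code g ≡ᵇ i in e
        ... | false = refl
        ... | true = subst (λ j → any (λ g' → code g' ≡ᵇ j) S ≡ false) (≡ᵇtrue⇒≡ _ _ e) (code-g-new g∉S)

    record Deletion (L : List A) (g : A) : Set where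
      field
        rest : List A
        rest⊆L : rest ⊆ L
        length-rest : length L ≡ suc (length rest)
        sum-rest : ∀ (f : A → ℕ) → sum (map f L) ≡ f g + sum (map f rest)
        keeps-others : ∀ y → y ∈ L → ¬ y ≡ g → y ∈ rest

    delete : ∀ (L : List A) g → g ∈ L → Deletion L g
    delete (x ∷ L) g (here refl) = record
      { rest = L ; rest⊆L = x ∷ʳ ⊆-refl ; length-rest = refl ; sum-rest = λ _ → refl ; keeps-others = keeps }
      where
      keeps : ∀ y → y ∈ x ∷ L → ¬ y ≡ x → y ∈ L
      keeps y (here y≡x) y≢x = ⊥-elim (y≢x y≡x)
      keeps y (there y∈L) _ = y∈L
    delete (x ∷ L) g (there g∈L) = record
      { rest = x ∷ rest ; rest⊆L = refl ∷ rest⊆L ; length-rest = cong suc length-rest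
      ; sum-rest = sum-rest' ; keeps-others = keeps }
      where
      open Deletion (delete L g g∈L)
      sum-rest' : ∀ (f : A → ℕ) → f x + sum (map f L) ≡ f g + (f x + sum (map f rest))
      sum-rest' f = begin
        f x + sum (map f L) ≡⟨ cong (f x +_) (sum-rest f) ⟩
        f x + (f g + sum (map f rest)) ≡⟨ sym (+-assoc (f x) _ _) ⟩
        f x + f g + sum (map f rest) ≡⟨ cong (_+ sum (map f rest)) (+-comm (f x) (f g)) ⟩
        f g + f x + sum (map f rest) ≡⟨ +-assoc (f g) _ _ ⟩
        f g + (f x + sum (map f rest)) ∎
        where open ≡-Reasoning
      keeps : ∀ y → y ∈ x ∷ L → ¬ y ≡ g → y ∈ x ∷ rest
      keeps y (here y≡x) _ = here y≡x
      keeps y (there y∈L) y≢g = there (keeps-others y y∈L y≢g)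

    delete-three : ∀ L g1 g2 g3 → g1 ∈ L → g2 ∈ L → g3 ∈ L → ¬ g1 ≡ g2 → ¬ g1 ≡ g3 → ¬ g2 ≡ g3 →
      Σ[ R ∈ List A ] R ⊆ L × length L ≡ 3 + length R ×
        (∀ (f : A → ℕ) → sum (map f L) ≡ f g1 + f g2 + f g3 + sum (map f R))
    delete-three L g1 g2 g3 g1∈ g2∈ g3∈ g1≢g2 g1≢g3 g2≢g3 =
      rest D3 , ⊆-trans (rest⊆L D3) (⊆-trans (rest⊆L D2) (rest⊆L D1)) , lengths , sums
      where
      open Deletion
      D1 : Deletion L g1
      D1 = delete L g1 g1∈
      D2 : Deletion (rest D1) g2
      D2 = delete (rest D1) g2 (keeps-others D1 g2 g2∈ (λ e → g1≢g2 (sym e)))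
      D3 : Deletion (rest D2) g3
      D3 = delete (rest D2) g3 (keeps-others D2 g3 (keeps-others D1 g3 g3∈ (λ e → g1≢g3 (sym e))) (λ e → g2≢g3 (sym e)))
      lengths : length L ≡ 3 + length (rest D3)
      lengths = trans (length-rest D1) (cong suc (trans (length-rest D2) (cong suc (length-rest D3))))
      sums : ∀ (f : A → ℕ) → sum (map f L) ≡ f g1 + f g2 + f g3 + sum (map f (rest D3))
      sums f = begin
        sum (map f L) ≡⟨ sum-rest D1 f ⟩
        f g1 + sum (map f (rest D1)) ≡⟨ cong (f g1 +_) (sum-rest D2 f) ⟩
        f g1 + (f g2 + sum (map f (rest D2))) ≡⟨ cong (λ z → f g1 + (f g2 + z)) (sum-rest D3 f) ⟩
        f g1 + (f g2 + (f g3 + sum (map f (rest D3)))) ≡⟨ regroup (f g1) (f g2) (f g3) _ ⟩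
        f g1 + f g2 + f g3 + sum (map f (rest D3)) ∎
        where
        open ≡-Reasoning
        regroup : ∀ a b c s → a + (b + (c + s)) ≡ a + b + c + s
        regroup a b c s = trans (sym (+-assoc a b (c + s))) (sym (+-assoc (a + b) c s))

module Encoding (q : ℕ) (p-prime : Prime (suc q)) (5≤p : 5 ≤ suc q) where

  open import Data.Nat
  open import Data.Nat.Properties
  open import Data.Nat.DivMod
  open import Data.Nat.Divisibility using (_∣_; divides; m%n≡0⇒n∣m; n∣m⇒m%n≡0; *-cancelˡ-∣; ∣⇒≤)
  open import Data.Nat.Coprimality using (coprime-divisor; prime⇒coprime)
  open import Data.Nat.Primality using (prime⇒irreducible)
  open import Data.Fin using (Fin; toℕ)
  open import Data.Fin.Properties using (toℕ<n; toℕ-injective; toℕ-fromℕ<)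
  open import Data.Product using (_×_; _,_; proj₁; proj₂)
  open import Data.Sum using (inj₁; inj₂)
  open import Data.Empty using (⊥-elim)
  open import Relation.Binary.PropositionalEquality
  open import Relation.Nullary using (¬_; yes; no)
  open import Data.Bool using (_∧_)
  open Counting using (≡ᵇ-refl; ≢⇒≡ᵇfalse)
  open import Defs
  open Sequences using (div-mod-unique; %-equal⇒∣∸)

  p : ℕ
  p = suc q

  no-divisor : ∀ d → 1 < d → d < p → ¬ d ∣ p
  no-divisor d 1<d d<p d∣p with prime⇒irreducible p-prime d∣p
  ... | inj₁ refl = <-irrefl refl 1<d
  ... | inj₂ refl = <-irrefl refl d<p

  half : ℕ
  half = p / 2

  p≡2h+1 : p ≡ suc (half + half)
  p≡2h+1 = begin
    p ≡⟨ m≡m%n+[m/n]*n p 2 ⟩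
    p % 2 + half * 2 ≡⟨ cong (_+ half * 2) odd ⟩
    suc (half * 2) ≡⟨ cong suc (trans (*-comm half 2) (cong (half +_) (+-identityʳ half))) ⟩
    suc (half + half) ∎
    where
    open ≡-Reasoning
    odd : p % 2 ≡ 1
    odd with p % 2 in p%2 | m%n<n p 2
    ... | 0 | _ = ⊥-elim (no-divisor 2 (s≤s (s≤s z≤n)) (≤-trans (s≤s (s≤s (s≤s z≤n))) 5≤p) (m%n≡0⇒n∣m p 2 p%2))
    ... | 1 | _ = refl
    ... | suc (suc _) | s≤s (s≤s ())

  2≤half : 2 ≤ half
  2≤half with half | p≡2h+1
  ... | 0 | p≡1 with subst (5 ≤_) p≡1 5≤p
  ...   | s≤s ()
  2≤half | 1 | p≡3 with subst (5 ≤_) p≡3 5≤p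
  ...   | s≤s (s≤s (s≤s ()))
  2≤half | suc (suc _) | _ = s≤s (s≤s z≤n)

  p²%3≡1 : (p * p) % 3 ≡ 1
  p²%3≡1 = trans (%-distribˡ-* p p 3) (square-of-unit (p % 3) refl (m%n<n p 3))
    where
    square-of-unit : ∀ r → p % 3 ≡ r → r < 3 → (r * r) % 3 ≡ 1
    square-of-unit 0 p%3≡0 _ = ⊥-elim (no-divisor 3 (s≤s (s≤s z≤n)) (≤-trans (s≤s (s≤s (s≤s (s≤s z≤n)))) 5≤p) (m%n≡0⇒n∣m p 3 p%3≡0))
    square-of-unit 1 _ _ = refl
    square-of-unit 2 _ _ = refl
    square-of-unit (suc (suc (suc _))) _ (s≤s (s≤s (s≤s ())))

  3∣∧p∣⇒3p∣ : ∀ {y} → 3 ∣ y → p ∣ y → 3 * p ∣ y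
  3∣∧p∣⇒3p∣ {y} (divides w refl) p∣3w with coprime-divisor {o = w} (prime⇒coprime p-prime 3<p) (subst (p ∣_) (*-comm w 3) p∣3w)
    where
    3<p : 3 < p
    3<p = ≤-trans (s≤s (s≤s (s≤s (s≤s z≤n)))) 5≤p
  ... | divides z refl = divides z (trans (*-assoc z p 3) (cong (z *_) (*-comm p 3)))

  crt : ∀ u v → u < 3 * p → v < 3 * p → u % 3 ≡ v % 3 → u % p ≡ v % p → u ≡ v
  crt u v u<3p v<3p u≡v[3] u≡v[p] = ≤-antisym (≤-half u v u<3p u≡v[3] u≡v[p]) (≤-half v u v<3p (sym u≡v[3]) (sym u≡v[p]))
    where
    ≤-half : ∀ u v → u < 3 * p → u % 3 ≡ v % 3 → u % p ≡ v % p → u ≤ v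
    ≤-half u v u<3p u≡v[3] u≡v[p] with u ∸ v in u∸v
    ... | zero = m∸n≡0⇒m≤n u∸v
    ... | suc d = ⊥-elim (<-irrefl refl (≤-trans u<3p (≤-trans (∣⇒≤ 3p∣u∸v) (subst (_≤ u) u∸v (m∸n≤m u v)))))
      where
      3p∣u∸v : 3 * p ∣ suc d
      3p∣u∸v = subst (3 * p ∣_) u∸v (3∣∧p∣⇒3p∣ (%-equal⇒∣∸ 3 u v u≡v[3]) (%-equal⇒∣∸ p u v u≡v[p]))

  first second : G p → ℕ
  first g = toℕ (proj₁ g)
  second g = toℕ (proj₂ g)

  -- The H₁-component π₁ g ≅ (a, x mod 3) ∈ (ℤ/3)² is recorded by the class
  -- 3a + (x mod 3) ∈ [0,9), the H₂-component by the residue x mod p.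
  class residue : G p → ℕ
  class g = first g * 3 + second g % 3
  residue g = second g % p

  residue<p : ∀ g → residue g < p
  residue<p g = m%n<n (second g) p

  class<9 : ∀ g → class g < 9
  class<9 g = begin-strict
    first g * 3 + second g % 3 <⟨ +-monoʳ-< (first g * 3) (m%n<n (second g) 3) ⟩
    first g * 3 + 3 ≡⟨ +-comm (first g * 3) 3 ⟩
    suc (first g) * 3 ≤⟨ *-monoˡ-≤ 3 (toℕ<n (proj₁ g)) ⟩
    9 ∎
    where open ≤-Reasoning

  class-coordinates : ∀ g c → class g ≡ c → first g ≡ c / 3 × second g % 3 ≡ c % 3
  class-coordinates g c refl = div-mod-unique 3 (first g) (second g % 3) (c / 3) (c % 3) (m%n<n (second g) 3) (m%n<n c 3)
    (trans (m≡m%n+[m/n]*n c 3) (+-comm (c % 3) _))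

  class-residue-injective : ∀ g g' → class g ≡ class g' → residue g ≡ residue g' → g ≡ g'
  class-residue-injective (a , x) (a' , x') same-class same-residue
    with div-mod-unique 3 (toℕ a) (toℕ x % 3) (toℕ a') (toℕ x' % 3) (m%n<n (toℕ x) 3) (m%n<n (toℕ x') 3) same-class
  ... | a≡a' , x≡x'[3] = cong₂ _,_ (toℕ-injective a≡a') (toℕ-injective (crt (toℕ x) (toℕ x') (toℕ<n x) (toℕ<n x') x≡x'[3] same-residue))

  π₁-second : ∀ g → toℕ (proj₂ (π₁ p g)) ≡ (p * p * second g) % (3 * p)
  π₁-second g = toℕ-fromℕ< _

  π₁-second%3 : ∀ g → toℕ (proj₂ (π₁ p g)) % 3 ≡ second g % 3
  π₁-second%3 g = begin
    toℕ (proj₂ (π₁ p g)) % 3 ≡⟨ cong (_% 3) (π₁-second g) ⟩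
    ((p * p * x) % (3 * p)) % 3 ≡⟨ m∣n⇒o%n%m≡o%m 3 (3 * p) (p * p * x) (divides p (*-comm 3 p)) ⟩
    (p * p * x) % 3 ≡⟨ %-distribˡ-* (p * p) x 3 ⟩
    ((p * p) % 3 * (x % 3)) % 3 ≡⟨ cong (λ z → (z * (x % 3)) % 3) p²%3≡1 ⟩
    (1 * (x % 3)) % 3 ≡⟨ cong (_% 3) (*-identityˡ (x % 3)) ⟩
    (x % 3) % 3 ≡⟨ m%n%n≡m%n x 3 ⟩
    x % 3 ∎
    where
    open ≡-Reasoning
    x = second g

  π₁-second%p : ∀ g → toℕ (proj₂ (π₁ p g)) % p ≡ 0
  π₁-second%p g = begin
    toℕ (proj₂ (π₁ p g)) % p ≡⟨ cong (_% p) (π₁-second g) ⟩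
    ((p * p * second g) % (3 * p)) % p ≡⟨ m∣n⇒o%n%m≡o%m p (3 * p) (p * p * second g) (divides 3 refl) ⟩
    (p * p * second g) % p ≡⟨ n∣m⇒m%n≡0 (p * p * second g) p (divides (p * second g) p-factor) ⟩
    0 ∎
    where
    open ≡-Reasoning
    p-factor : p * p * second g ≡ p * second g * p
    p-factor = trans (*-assoc p p (second g)) (*-comm p (p * second g))

  π₁-of-class : ∀ g h → InH₁ p h → class g ≡ class h → π₁ p g ≡ h
  π₁-of-class g (a , y) 3p∣3y same-class
    with div-mod-unique 3 (first g) (second g % 3) (toℕ a) (toℕ y % 3) (m%n<n (second g) 3) (m%n<n (toℕ y) 3) same-class
  ... | a≡ , x≡y[3] = cong₂ _,_ (toℕ-injective a≡) (toℕ-injective (crt _ _ (toℕ<n (proj₂ (π₁ p g))) (toℕ<n y)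
        (trans (π₁-second%3 g) x≡y[3]) (trans (π₁-second%p g) (sym (n∣m⇒m%n≡0 (toℕ y) p (*-cancelˡ-∣ 3 3p∣3y))))))

  code : G p → ℕ
  code g = class g * p + residue g

  code<9p : ∀ g → code g < 9 * p
  code<9p g = begin-strict
    class g * p + residue g <⟨ +-monoʳ-< (class g * p) (residue<p g) ⟩
    class g * p + p ≡⟨ +-comm (class g * p) p ⟩
    suc (class g) * p ≤⟨ *-monoˡ-≤ p (class<9 g) ⟩
    9 * p ∎
    where open ≤-Reasoning

  code-injective : ∀ g g' → code g ≡ code g' → g ≡ g'
  code-injective g g' same-code =
    let same-class , same-residue = div-mod-unique p _ _ _ _ (residue<p g) (residue<p g') same-code
    in class-residue-injective g g' same-class same-residue

  code-≡ᵇ : ∀ g c k → k < p → (code g ≡ᵇ c * p + k) ≡ ((class g ≡ᵇ c) ∧ (residue g ≡ᵇ k))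
  code-≡ᵇ g c k k<p with class g ≟ c | residue g ≟ k
  ... | yes refl | yes refl rewrite ≡ᵇ-refl (code g) | ≡ᵇ-refl (class g) | ≡ᵇ-refl (residue g) = refl
  ... | no c≢ | _ rewrite ≢⇒≡ᵇfalse (class g) c c≢ =
    ≢⇒≡ᵇfalse (code g) (c * p + k) (λ e → c≢ (proj₁ (div-mod-unique p (class g) (residue g) c k (residue<p g) k<p e)))
  ... | yes refl | no k≢ rewrite ≡ᵇ-refl (class g) | ≢⇒≡ᵇfalse (residue g) k k≢ =
    ≢⇒≡ᵇfalse (code g) (class g * p + k) (λ e → k≢ (proj₂ (div-mod-unique p (class g) (residue g) (class g) k (residue<p g) k<p e)))

module Reduction (q : ℕ) (p-prime : Prime (suc q)) (5≤p : 5 ≤ suc q) (S : List (G (suc q))) (unique : Unique S)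
                 (|S| : length S ≡ 3 * suc q + 3) (σπ₁S : σ≡0 (suc q) (map (π₁ (suc q)) S)) where

  open import Data.Nat
  open import Data.Nat.Properties
  open import Data.Nat.DivMod
  open import Data.Nat.Tactic.RingSolver using (solve-∀)
  open import Data.List.Relation.Unary.All as All using ()
  open import Data.Nat.Divisibility using (_∣_; divides; ∣m+n∣m⇒∣n; m*n∣⇒m∣; m%n≡0⇒n∣m; n∣m⇒m%n≡0)
  open import Data.Nat.ListAction using (sum)
  open import Data.Bool using (Bool; true; _∧_)
  open import Data.Bool.ListAction using (any)
  open import Data.Fin using (toℕ)
  open import Data.Product using (Σ-syntax; _,_; proj₁; proj₂)
  open import Data.Sum using (_⊎_; inj₁; inj₂)
  import Data.Sum as Sum
  open import Data.List.Properties using (map-∘)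
  open import Data.List.Membership.Propositional.Properties using (∈-map⁺)
  open import Data.Empty using (⊥-elim)
  open import Relation.Binary.PropositionalEquality
  open import Relation.Nullary using (yes; no)
  open Counting
  open Sequences
  open Encoding q p-prime 5≤p
  open Residues p
  open SumSets p
  open SumsetCorollaries p p-prime
  open AffinePlane
  open HeavyLine
  module Mod3 = Residues 3

  Solution : Set
  Solution = Σ (List (G p)) (λ T → T ⊆ S × length T ≡ 3 * p × σ≡0 p T)

  Σfirst Σsecond : List (G p) → ℕ
  Σfirst L = sum (map first L)
  Σsecond L = sum (map second L)

  -- π₁ keeps the first coordinate and the second one mod 3, so σ(π₁(S)) = 0
  -- says that 3 divides both coordinate sums of S.
  3∣Σfirst : 3 ∣ Σfirst S
  3∣Σfirst = subst (3 ∣_) (cong sum (sym (map-∘ S))) (proj₁ σπ₁S)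

  3∣Σsecond : 3 ∣ Σsecond S
  3∣Σsecond = m%n≡0⇒n∣m (Σsecond S) 3 (begin
    Σsecond S % 3 ≡⟨ sum-map-% 3 S second (λ g → toℕ (proj₂ (π₁ p g))) (λ g → sym (π₁-second%3 g)) ⟩
    sum (map (λ g → toℕ (proj₂ (π₁ p g))) S) % 3 ≡⟨ cong (λ L → sum L % 3) (map-∘ S) ⟩
    sum (map (λ g → toℕ (proj₂ g)) (map (π₁ p) S)) % 3 ≡⟨ n∣m⇒m%n≡0 _ 3 (m*n∣⇒m∣ 3 p (proj₂ σπ₁S)) ⟩
    0 ∎)
    where open ≡-Reasoning

  -- the H₂-component of σ(S), as a residue mod p
  t : ℕ
  t = Σsecond S % p

  t<p : t < p
  t<p = m%n<n (Σsecond S) p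

  solution-from-triple : ∀ g1 g2 g3 → g1 ∈ S → g2 ∈ S → g3 ∈ S → ¬ g1 ≡ g2 → ¬ g1 ≡ g3 → ¬ g2 ≡ g3 →
    3 ∣ first g1 + first g2 + first g3 → 3 ∣ second g1 % 3 + second g2 % 3 + second g3 % 3 →
    (residue g1 + residue g2 + residue g3) % p ≡ t → Solution
  solution-from-triple g1 g2 g3 g1∈ g2∈ g3∈ g1≢g2 g1≢g3 g2≢g3 3∣firsts 3∣seconds%3 residues≡t
    with delete-three S g1 g2 g3 g1∈ g2∈ g3∈ g1≢g2 g1≢g3 g2≢g3
  ... | R , R⊆S , |S|≡3+|R| , split = R , R⊆S , |R| , 3∣Σfirst-R , 3∣∧p∣⇒3p∣ 3∣Σsecond-R p∣Σsecond-R
    where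
    open ≡-Reasoning
    X = second g1 + second g2 + second g3
    |R| : length R ≡ 3 * p
    |R| = +-cancelˡ-≡ 3 _ _ (trans (sym |S|≡3+|R|) (trans |S| (+-comm (3 * p) 3)))
    3∣Σfirst-R : 3 ∣ Σfirst R
    3∣Σfirst-R = ∣m+n∣m⇒∣n (subst (3 ∣_) (split first) 3∣Σfirst) 3∣firsts
    3∣X : 3 ∣ X
    3∣X = m%n≡0⇒n∣m X 3 (trans (Mod3.%-sum3 (second g1) (second g2) (second g3)) (n∣m⇒m%n≡0 _ 3 3∣seconds%3))
    3∣Σsecond-R : 3 ∣ Σsecond R
    3∣Σsecond-R = ∣m+n∣m⇒∣n (subst (3 ∣_) (split second) 3∣Σsecond) 3∣X
    X≡t : X % p ≡ t
    X≡t = trans (%-sum3 (second g1) (second g2) (second g3)) residues≡t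
    p∣Σsecond-R : p ∣ Σsecond R
    p∣Σsecond-R = subst (p ∣_) (m+n∸m≡n X (Σsecond R))
      (%-equal⇒∣∸ p (X + Σsecond R) X (trans (cong (_% p) (sym (split second))) (sym X≡t)))

  -- The residues of the elements of S in class c, as a subset A_c of ℤ/p.
  classSet : ℕ → ℕ → Bool
  classSet c k = any (λ g → (class g ≡ᵇ c) ∧ (residue g ≡ᵇ k)) S

  in-class : ∀ c k → classSet c k ≡ true → Σ[ g ∈ G p ] g ∈ S × class g ≡ c × residue g ≡ k
  in-class c k k∈A_c with any-elim S _ k∈A_c
  ... | g , g∈S , matches = g , g∈S , ≡ᵇtrue⇒≡ _ _ (∧-l matches) , ≡ᵇtrue⇒≡ _ _ (∧-r {class g ≡ᵇ c} matches)

  size : ℕ → ℕ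
  size c = ∣ classSet c ∣

  -- As S is squarefree and g ↦ (class, residue) is injective, Σ_c |A_c| = |S| = 3p + 3.
  sizes-total : sumBelow 9 size ≡ 3 * p + 3
  sizes-total = begin
    sumBelow 9 size
      ≡⟨ sumBelow-cong 9 (λ c _ → count-cong p (λ k k<p → any-cong S (λ g → sym (code-≡ᵇ g c k k<p)))) ⟩
    sumBelow 9 (λ c → count p (λ k → coded (c * p + k)))
      ≡⟨ count-blocks 9 ⟩
    count (9 * p) coded
      ≡⟨ count-codes code (9 * p) S unique code<9p code-injective ⟩
    length S
      ≡⟨ |S| ⟩
    3 * p + 3 ∎
    where
    open ≡-Reasoning
    coded : ℕ → Bool
    coded i = any (λ g → code g ≡ᵇ i) S
    count-blocks : ∀ m → sumBelow m (λ c → count p (λ k → coded (c * p + k))) ≡ count (m * p) coded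
    count-blocks zero = refl
    count-blocks (suc m) = trans (cong (count p (λ k → coded (m * p + k)) +_) (count-blocks m))
                                 (sym (count-+ p (m * p) coded))

  differ : ∀ {g g' a a' r r'} → class g ≡ a → class g' ≡ a' → residue g ≡ r → residue g' ≡ r' →
    ¬ a ≡ a' ⊎ ¬ r ≡ r' → ¬ g ≡ g'
  differ refl refl _ _ (inj₁ a≢a') refl = a≢a' refl
  differ _ _ refl refl (inj₂ r≢r') refl = r≢r' refl

  solution-from-class-sets : ∀ i j k r1 r2 r3 → classSet i r1 ≡ true → classSet j r2 ≡ true → classSet k r3 ≡ true →
    3 ∣ i / 3 + j / 3 + k / 3 → 3 ∣ i % 3 + j % 3 + k % 3 → (r1 + r2 + r3) % p ≡ t →
    (¬ i ≡ j × ¬ i ≡ k × ¬ j ≡ k) ⊎ (¬ r1 ≡ r2 × ¬ r1 ≡ r3 × ¬ r2 ≡ r3) → Solution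
  solution-from-class-sets i j k r1 r2 r3 r1∈A_i r2∈A_j r3∈A_k 3∣firsts 3∣seconds sum≡t distinct
    with in-class i r1 r1∈A_i | in-class j r2 r2∈A_j | in-class k r3 r3∈A_k
  ... | g1 , g1∈S , c1 , e1 | g2 , g2∈S , c2 , e2 | g3 , g3∈S , c3 , e3 =
    solution-from-triple g1 g2 g3 g1∈S g2∈S g3∈S
      (differ c1 c2 e1 e2 (Sum.map (λ (≢ , _ , _) → ≢) (λ (≢ , _ , _) → ≢) distinct))
      (differ c1 c3 e1 e3 (Sum.map (λ (_ , ≢ , _) → ≢) (λ (_ , ≢ , _) → ≢) distinct))
      (differ c2 c3 e2 e3 (Sum.map (λ (_ , _ , ≢) → ≢) (λ (_ , _ , ≢) → ≢) distinct))
      (subst (3 ∣_) (sym (sum3 (proj₁ d1) (proj₁ d2) (proj₁ d3))) 3∣firsts)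
      (subst (3 ∣_) (sym (sum3 (proj₂ d1) (proj₂ d2) (proj₂ d3))) 3∣seconds)
      (trans (cong (_% p) (sum3 e1 e2 e3)) sum≡t)
    where
    d1 : first g1 ≡ i / 3 × second g1 % 3 ≡ i % 3
    d1 = class-coordinates g1 i c1
    d2 : first g2 ≡ j / 3 × second g2 % 3 ≡ j % 3
    d2 = class-coordinates g2 j c2
    d3 : first g3 ≡ k / 3 × second g3 % 3 ≡ k % 3
    d3 = class-coordinates g3 k c3
    sum3 : ∀ {a1 a2 a3 b1 b2 b3 : ℕ} → a1 ≡ b1 → a2 ≡ b2 → a3 ≡ b3 → a1 + a2 + a3 ≡ b1 + b2 + b3
    sum3 refl refl refl = refl

  -- Case 1: some class c has |A_c| ≥ (p + 5)/2.  Three distinct residues of A_c sum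
  -- to t, and three elements of one class sum to zero in H₁.
  heavy-class-case : ∀ c → p + 5 ≤ size c + size c → Solution
  heavy-class-case c heavy =
    let r1 , r2 , r3 , r1∈ , r2∈ , r3∈ , r1≢r2 , r1≢r3 , r2≢r3 , sum≡t =
          distinct-three-term-sums half p≡2h+1 (classSet c) heavy t t<p
    in solution-from-class-sets c c c r1 r2 r3 r1∈ r2∈ r3∈ (divides (c / 3) (thrice (c / 3))) (divides (c % 3) (thrice (c % 3)))
         sum≡t (inj₂ (r1≢r2 , r1≢r3 , r2≢r3))
    where
    thrice : ∀ a → a + a + a ≡ a * 3
    thrice = solve-∀

  sizes-total-in-h : sumBelow 9 size ≡ 6 * half + 6
  sizes-total-in-h = trans sizes-total (trans (cong (λ z → 3 * z + 3) p≡2h+1) (identity half))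
    where
    identity : ∀ h → 3 * suc (h + h) + 3 ≡ 6 * h + 6
    identity = solve-∀

  2h+3≡p+2 : 2 * half + 3 ≡ p + 2
  2h+3≡p+2 = trans (identity half) (cong (_+ 2) (sym p≡2h+1))
    where
    identity : ∀ h → 2 * h + 3 ≡ suc (h + h) + 2
    identity = solve-∀

  -- Case 2: every |A_c| ≤ h + 2 and some class is empty.  Then some line {i, j, k} of
  -- the plane has nonempty A_i, A_j, A_k with |A_i| + |A_j| + |A_k| ≥ p + 2, so by
  -- Cauchy–Davenport A_i + A_j + A_k ∋ t, and the classes of a line sum to zero.
  line-case : (∀ c → c < 9 → size c ≤ half + 2) → ∀ m → m < 9 → size m ≡ 0 → Solution
  line-case capped m m<9 empty =
    let i , j , k , L∈lines , 1≤∣A_i∣ , 1≤∣A_j∣ , 1≤∣A_k∣ , heavy =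
          Weighting.heavy-line half size capped sizes-total-in-h 2≤half m m<9 empty
        r1 , r2 , r3 , r1∈ , r2∈ , r3∈ , sum≡t =
          three-term-sums (classSet i) (classSet j) (classSet k) 1≤∣A_i∣ 1≤∣A_j∣ 1≤∣A_k∣
            (subst (_≤ size i + size j + size k) 2h+3≡p+2 heavy) t t<p
        3∣firsts , 3∣seconds , i≢j , i≢k , j≢k = All.lookup lines-zero-sum L∈lines
    in solution-from-class-sets i j k r1 r2 r3 r1∈ r2∈ r3∈ 3∣firsts 3∣seconds sum≡t (inj₁ (i≢j , i≢k , j≢k))

  capped : ∀ c → ¬ p + 5 ≤ size c + size c → size c ≤ half + 2
  capped c not-heavy with size c ≤? half + 2
  ... | yes small = small
  ... | no large = ⊥-elim (not-heavy (subst (_≤ size c + size c) 2[h+3]≡p+5 (+-mono-≤ h+3≤ h+3≤)))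
    where
    h+3≤ : half + 3 ≤ size c
    h+3≤ = subst (_≤ size c) (sym (+-suc half 2)) (≰⇒> large)
    2[h+3]≡p+5 : half + 3 + (half + 3) ≡ p + 5
    2[h+3]≡p+5 = trans (identity half) (cong (_+ 5) (sym p≡2h+1))
      where
      identity : ∀ h → h + 3 + (h + 3) ≡ suc (h + h) + 5
      identity = solve-∀

  covering : (∀ c → c < 9 → 1 ≤ size c) → ∀ h → InH₁ p h → h ∈ map (π₁ p) S
  covering occupied h h∈H₁ with count-pos p (classSet (class h)) (occupied (class h) (class<9 h))
  ... | r , _ , r∈ with in-class (class h) r r∈
  ...   | g , g∈S , same-class , _ = subst (_∈ map (π₁ p) S) (π₁-of-class g h h∈H₁ same-class) (∈-map⁺ (π₁ p) g∈S)

-- Proof of the proposition: either some class set is heavy (case 1), or all are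
-- capped and, since π₁(S) misses a point of H₁, some class is empty (case 2).
proposition3p8 : (p : ℕ) → Prime p → 5 ≤ p → (S : List (G p)) → Unique S → length S ≡ 3 * p + 3
    → σ≡0 p (map (π₁ p) S)
    → ¬ ((h : G p) → InH₁ p h → h ∈ map (π₁ p) S)
    → Σ (List (G p)) (λ T → T ⊆ S × length T ≡ 3 * p × σ≡0 p T)
proposition3p8 (suc q) p-prime 5≤p S unique |S| σπ₁S not-all = by-cases (anyUpTo? heavy? 9) (anyUpTo? empty? 9)
  where
  open Reduction q p-prime 5≤p S unique |S| σπ₁S
  heavy? : ∀ c → Dec (suc q + 5 ≤ size c + size c)
  heavy? c = suc q + 5 ≤? size c + size c
  empty? : ∀ c → Dec (size c ≡ 0)
  empty? c = size c ≟ 0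
  by-cases : Dec (∃[ c ] c < 9 × suc q + 5 ≤ size c + size c) → Dec (∃[ c ] c < 9 × size c ≡ 0) → Solution
  by-cases (yes (c , _ , heavy)) _ = heavy-class-case c heavy
  by-cases (no none-heavy) (yes (m , m<9 , empty)) =
    line-case (λ c c<9 → capped c (λ heavy → none-heavy (c , c<9 , heavy))) m m<9 empty
  by-cases (no _) (no none-empty) =
    ⊥-elim (not-all (covering (λ c c<9 → n≢0⇒n>0 (λ empty → none-empty (c , c<9 , empty)))))
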